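{- For every positive integer $n \neq 3$, $d(n)=2^{n-1}$, and a set $A$ of $n$ positive integers satisfies $d(A)=2^{n-1}$ if and only if $A$ is an anti-pencil or $A=\{a,2a,3a,6a\}$ for some positive integer $a$. For $n=3$, $d(3)=5$, and a set $A$ of three positive integers satisfies $d(A)=5$ if and only if $A=\{a,2a,3a\}$ for some positive integer $a$.
   Context: For a finite set $A$ of positive integers, write $\sum A$ for the sum of its elements (with $\sum\emptyset=0$). A subset $B\subseteq A$ is a divisor of $A$ if $\sum B$ divides $\sum A$ (so the empty set is not a divisor of a nonempty $A$, while $A$ itself is). Let $d(A)$ be the number of divisors of $A$, and $d(n)$ the maximum of $d(A)$ over all sets $A$ of $n$ positive integers. If $A=\{a_1,\dots,a_n\}$ with $a_1<\dots<a_n$, then $A$ is an anti-pencil if the set of divisors of $A$ consists exactly of all non-empty subsets of $A\setminus\{a_n\}$ together with $A$ itself. -}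

module Defs where

open import Data.Nat using (ℕ; zero; suc; _+_; _*_; _<_; _≤_)
open import Data.Nat.Divisibility using (_∣_; _∣?_)
open import Data.Bool using (Bool; true; false)
open import Data.Fin as Fin using (Fin)
open import Data.Fin.Subset using (Subset; ⊤; Nonempty; _∉_)
open import Data.Vec using (Vec; []; _∷_; lookup)
open import Data.List using (List; []; _∷_; map; _++_; filter; length)
open import Data.Sum using (_⊎_)
open import Data.Product using (_×_)
open import Function.Bundles using (_⇔_)
open import Relation.Binary.PropositionalEquality using (_≡_)

total : ∀ {n} → Vec ℕ n → ℕ
total []       = 0
total (a ∷ as) = a + total as

subSum : ∀ {n} → Vec ℕ n → Subset n → ℕ
subSum []       []           = 0
subSum (a ∷ as) (true  ∷ bs) = a + subSum as bs
subSum (a ∷ as) (false ∷ bs) = subSum as bs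

-- A set of n positive integers a₁ < … < aₙ, represented by the sorted vector.
IsPosSet : ∀ {n} → Vec ℕ n → Set
IsPosSet {n} A =
  (∀ (i : Fin n) → 0 < lookup A i) ×
  (∀ (i j : Fin n) → i Fin.< j → lookup A i < lookup A j)

IsDivisor : ∀ {n} → Vec ℕ n → Subset n → Set
IsDivisor A B = subSum A B ∣ total A

allSubsets : (n : ℕ) → List (Subset n)
allSubsets zero    = [] ∷ []
allSubsets (suc n) = map (true ∷_) (allSubsets n) ++ map (false ∷_) (allSubsets n)

d : ∀ {n} → Vec ℕ n → ℕ
d {n} A = length (filter (λ B → subSum A B ∣? total A) (allSubsets n))

-- Anti-pencil (for n = suc m ≥ 1 elements; the last index Fin.fromℕ m is aₙ):
-- the divisors are exactly the nonempty subsets avoiding aₙ, together with A.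
AntiPencil : ∀ {m} → Vec ℕ (suc m) → Set
AntiPencil {m} A =
  ∀ (B : Subset (suc m)) →
    IsDivisor A B ⇔ ((Nonempty B × Fin.fromℕ m ∉ B) ⊎ B ≡ ⊤)

-- Pair every B ⊆ A with its complement. Summing 𝟙[B is a divisor] + 𝟙[∁ B is a divisor] over all B gives
-- 2 d(A) + Z = 2ⁿ + H, where H counts the B for which both B and ∁ B divide ∑A (so ∑B = ∑A/2) and Z those for
-- which neither does; thus d(A) ≤ 2ⁿ⁻¹ amounts to H ≤ Z. If the half h = ∑A/2 is attained and some element x < h
-- has h - x ∤ ∑A, then toggling x maps the sets counted by H injectively to sets counted by Z, since sums h ± x
-- cannot divide 2h. An element without this property satisfies one of four rigid relations with h, and four
-- elements of total at most 2h cannot all be rigid. So for n ≥ 4 a good element exists among the four smallest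
-- (H ≤ Z), and for n ≥ 5 two exist, which makes the injection miss a set; equality then forces H = Z = 0, i.e.
-- exactly one set of each complementary pair divides. In that case a divisor B ∋ aₙ other than A would satisfy
-- ∑B ≤ ∑A/3, so every element is at most ∑A/3 and a greedy choice produces a set with sum strictly between ∑A/3
-- and 2∑A/3; whichever of it and its complement divides would be a half, which is impossible. Hence A is an
-- anti-pencil. Sets of at most four elements are settled by listing their subsets, which yields the exceptions
-- {a, 2a, 3a} and {a, 2a, 3a, 6a}.

module Submission where

open import Defs
open import Data.Nat using (ℕ; zero; suc; _+_; _*_; _∸_; _^_; _≤_; _<_; _<ᵇ_; z≤n; s≤s; _≤?_; _<?_; _!; >-nonZero)
open import Data.Nat.Properties
open import Data.Nat.Divisibility
  using (_∣_; _∣?_; divides; ∣-refl; ∣-trans; 0∣⇒≡0; m≤n⇒m!∣n!; m∣m*n; n∣m*n; *-monoˡ-∣; *-cancelʳ-∣)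
open import Data.Nat.Tactic.RingSolver using (solve-∀)
open import Data.Bool using (true; false; not; T)
import Data.Bool.Properties as Bool
open import Data.Fin as Fin using (Fin; fromℕ; toℕ; #_)
open import Data.Fin.Properties using (toℕ-fromℕ; toℕ-injective; toℕ<n) renaming (suc-injective to Fin-suc-injective)
open import Data.Fin.Subset using (Subset; ∁; ⊤; ⁅_⁆; _∈_; _∉_; Nonempty) renaming (⊥ to ∅)
open import Data.Fin.Subset.Properties using (_∈?_; ∈⊤; x∈p⇒x∉∁p; x∉p⇒x∈∁p; nonempty?; Empty-unique)
open import Data.Vec using (Vec; []; _∷_; lookup; toList; here; there)
import Data.Vec
open import Data.Vec.Properties using (≡-dec)
open import Data.List using (List; []; _∷_; _++_; map; filter; length)
open import Data.List.Properties using (map-++; map-∘)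
open import Data.Nat.ListAction using (sum)
open import Data.Nat.ListAction.Properties using (sum-++)
open import Data.Product using (_×_; _,_; ∃; ∃-syntax; proj₁; proj₂)
open import Data.Sum using (_⊎_; inj₁; inj₂)
open import Data.Empty using (⊥; ⊥-elim)
open import Function using (_∘_)
open import Function.Bundles using (_⇔_; mk⇔; Equivalence)
open import Relation.Nullary using (Dec; yes; no; ¬_; contradiction)
open import Relation.Nullary.Decidable using (_×-dec_; ¬?; decidable-stable)
open import Relation.Unary using (Decidable)
open import Relation.Binary.PropositionalEquality

private
  variable
    n m : ℕ

𝟙 : {P : Set} → Dec P → ℕ
𝟙 (yes _) = 1
𝟙 (no _)  = 0

𝟙≤1 : {P : Set} (P? : Dec P) → 𝟙 P? ≤ 1
𝟙≤1 (yes _) = s≤s z≤n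
𝟙≤1 (no _)  = z≤n

𝟙-yes : {P : Set} (P? : Dec P) → P → 𝟙 P? ≡ 1
𝟙-yes (yes _) _ = refl
𝟙-yes (no ¬p) p = contradiction p ¬p

𝟙-no : {P : Set} (P? : Dec P) → ¬ P → 𝟙 P? ≡ 0
𝟙-no (yes p) ¬p = contradiction p ¬p
𝟙-no (no _)  _  = refl

𝟙≡1⇒ : {P : Set} (P? : Dec P) → 𝟙 P? ≡ 1 → P
𝟙≡1⇒ (yes p) _ = p

𝟙≡0⇒¬ : {P : Set} (P? : Dec P) → 𝟙 P? ≡ 0 → ¬ P
𝟙≡0⇒¬ (no ¬p) _ = ¬p

𝟙-mono : {P Q : Set} (P? : Dec P) (Q? : Dec Q) → (P → Q) → 𝟙 P? ≤ 𝟙 Q?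
𝟙-mono (yes p) Q?     P⇒Q = ≤-reflexive (sym (𝟙-yes Q? (P⇒Q p)))
𝟙-mono (no _)  _      _   = z≤n

𝟙-cong : {P Q : Set} (P? : Dec P) (Q? : Dec Q) → (P → Q) → (Q → P) → 𝟙 P? ≡ 𝟙 Q?
𝟙-cong P? Q? P⇒Q Q⇒P = ≤-antisym (𝟙-mono P? Q? P⇒Q) (𝟙-mono Q? P? Q⇒P)

𝟙-pair : {P Q : Set} (P? : Dec P) (Q? : Dec Q) → 𝟙 P? + 𝟙 Q? + 𝟙 (¬? P? ×-dec ¬? Q?) ≡ 1 + 𝟙 (P? ×-dec Q?)
𝟙-pair (yes _) (yes _) = refl
𝟙-pair (yes _) (no _)  = refl
𝟙-pair (no _)  (yes _) = refl
𝟙-pair (no _)  (no _)  = refl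

𝟙+𝟙≥2 : {P Q : Set} (P? : Dec P) (Q? : Dec Q) → 2 ≤ 𝟙 P? + 𝟙 Q? → P × Q
𝟙+𝟙≥2 (yes p) (yes q) _           = p , q
𝟙+𝟙≥2 (yes _) (no _)  (s≤s ())
𝟙+𝟙≥2 (no _)  (yes _) (s≤s ())
𝟙+𝟙≥2 (no _)  (no _)  ()

𝟙+𝟙+𝟙≥3 : {P Q R : Set} (P? : Dec P) (Q? : Dec Q) (R? : Dec R) → 3 ≤ 𝟙 P? + (𝟙 Q? + 𝟙 R?) → P × Q × R
𝟙+𝟙+𝟙≥3 (yes p) (yes q) (yes r) _ = p , q , r
𝟙+𝟙+𝟙≥3 (yes _) (yes _) (no _)  (s≤s (s≤s ()))
𝟙+𝟙+𝟙≥3 (yes _) (no _)  (yes _) (s≤s (s≤s ()))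
𝟙+𝟙+𝟙≥3 (yes _) (no _)  (no _)  (s≤s ())
𝟙+𝟙+𝟙≥3 (no _)  (yes _) (yes _) (s≤s (s≤s ()))
𝟙+𝟙+𝟙≥3 (no _)  (yes _) (no _)  (s≤s ())
𝟙+𝟙+𝟙≥3 (no _)  (no _)  (yes _) (s≤s ())
𝟙+𝟙+𝟙≥3 (no _)  (no _)  (no _)  ()

𝟙-at-most-one : {P Q R : Set} (P? : Dec P) (Q? : Dec Q) (R? : Dec R) →
  (P → Q → ⊥) → (P → R → ⊥) → (Q → R → ⊥) → 𝟙 P? + (𝟙 Q? + 𝟙 R?) ≤ 1
𝟙-at-most-one (yes p) (yes q) _       pq _  _  = ⊥-elim (pq p q)
𝟙-at-most-one (yes p) (no _)  (yes r) _  pr _  = ⊥-elim (pr p r)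
𝟙-at-most-one (yes _) (no _)  (no _)  _  _  _  = ≤-refl
𝟙-at-most-one (no _)  (yes q) (yes r) _  _  qr = ⊥-elim (qr q r)
𝟙-at-most-one (no _)  (yes _) (no _)  _  _  _  = ≤-refl
𝟙-at-most-one (no _)  (no _)  (yes _) _  _  _  = ≤-refl
𝟙-at-most-one (no _)  (no _)  (no _)  _  _  _  = z≤n

length-filter≡sum-𝟙 : {X : Set} {P : X → Set} (P? : Decidable P) (xs : List X) →
  length (filter P? xs) ≡ sum (map (𝟙 ∘ P?) xs)
length-filter≡sum-𝟙 P? [] = refl
length-filter≡sum-𝟙 P? (x ∷ xs) with P? x
... | yes _ = cong suc (length-filter≡sum-𝟙 P? xs)
... | no _  = length-filter≡sum-𝟙 P? xs

-- Sums over all subsets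

sumSubsets : ∀ n → (Subset n → ℕ) → ℕ
sumSubsets zero    f = f []
sumSubsets (suc n) f = sumSubsets n (f ∘ (true ∷_)) + sumSubsets n (f ∘ (false ∷_))

sum-map-allSubsets : ∀ n (f : Subset n → ℕ) → sum (map f (allSubsets n)) ≡ sumSubsets n f
sum-map-allSubsets zero    f = +-identityʳ (f [])
sum-map-allSubsets (suc n) f = begin
  sum (map f (map (true ∷_) Bs ++ map (false ∷_) Bs))
    ≡⟨ cong sum (map-++ f (map (true ∷_) Bs) (map (false ∷_) Bs)) ⟩
  sum (map f (map (true ∷_) Bs) ++ map f (map (false ∷_) Bs))
    ≡⟨ sum-++ (map f (map (true ∷_) Bs)) _ ⟩
  sum (map f (map (true ∷_) Bs)) + sum (map f (map (false ∷_) Bs))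
    ≡⟨ cong₂ _+_ (cong sum (sym (map-∘ Bs))) (cong sum (sym (map-∘ Bs))) ⟩
  sum (map (f ∘ (true ∷_)) Bs) + sum (map (f ∘ (false ∷_)) Bs)
    ≡⟨ cong₂ _+_ (sum-map-allSubsets n _) (sum-map-allSubsets n _) ⟩
  sumSubsets (suc n) f ∎
  where
  open ≡-Reasoning
  Bs : List (Subset n)
  Bs = allSubsets n

sumSubsets-cong : ∀ n {f g : Subset n → ℕ} → (∀ B → f B ≡ g B) → sumSubsets n f ≡ sumSubsets n g
sumSubsets-cong zero    f≗g = f≗g []
sumSubsets-cong (suc n) f≗g =
  cong₂ _+_ (sumSubsets-cong n (f≗g ∘ (true ∷_))) (sumSubsets-cong n (f≗g ∘ (false ∷_)))

sumSubsets-mono-≤ : ∀ n {f g : Subset n → ℕ} → (∀ B → f B ≤ g B) → sumSubsets n f ≤ sumSubsets n g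
sumSubsets-mono-≤ zero    f≤g = f≤g []
sumSubsets-mono-≤ (suc n) f≤g =
  +-mono-≤ (sumSubsets-mono-≤ n (f≤g ∘ (true ∷_))) (sumSubsets-mono-≤ n (f≤g ∘ (false ∷_)))

sumSubsets-mono-< : ∀ n {f g : Subset n → ℕ} → (∀ B → f B ≤ g B) →
  ∀ B₀ → f B₀ < g B₀ → sumSubsets n f < sumSubsets n g
sumSubsets-mono-< zero    f≤g [] lt = lt
sumSubsets-mono-< (suc n) f≤g (true ∷ B₀) lt =
  +-mono-<-≤ (sumSubsets-mono-< n (f≤g ∘ (true ∷_)) B₀ lt) (sumSubsets-mono-≤ n (f≤g ∘ (false ∷_)))
sumSubsets-mono-< (suc n) f≤g (false ∷ B₀) lt =
  +-mono-≤-< (sumSubsets-mono-≤ n (f≤g ∘ (true ∷_))) (sumSubsets-mono-< n (f≤g ∘ (false ∷_)) B₀ lt)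

sumSubsets-+ : ∀ n (f g : Subset n → ℕ) →
  sumSubsets n (λ B → f B + g B) ≡ sumSubsets n f + sumSubsets n g
sumSubsets-+ zero    f g = refl
sumSubsets-+ (suc n) f g rewrite sumSubsets-+ n (f ∘ (true ∷_)) (g ∘ (true ∷_))
                               | sumSubsets-+ n (f ∘ (false ∷_)) (g ∘ (false ∷_)) =
  +-+-comm (sumSubsets n (f ∘ (true ∷_))) _ _ _
  where
  +-+-comm : ∀ a b c e → (a + b) + (c + e) ≡ (a + c) + (b + e)
  +-+-comm = solve-∀

sumSubsets-1 : ∀ n → sumSubsets n (λ _ → 1) ≡ 2 ^ n
sumSubsets-1 zero    = refl
sumSubsets-1 (suc n) = cong₂ _+_ (sumSubsets-1 n) (trans (sumSubsets-1 n) (sym (+-identityʳ (2 ^ n))))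

sumSubsets-∁ : ∀ n (f : Subset n → ℕ) → sumSubsets n (f ∘ ∁) ≡ sumSubsets n f
sumSubsets-∁ zero    f = refl
sumSubsets-∁ (suc n) f = trans
  (cong₂ _+_ (sumSubsets-∁ n (f ∘ (false ∷_))) (sumSubsets-∁ n (f ∘ (true ∷_))))
  (+-comm (sumSubsets n (f ∘ (false ∷_))) _)

sumSubsets>0 : ∀ n (f : Subset n → ℕ) → 0 < sumSubsets n f → ∃[ B ] (0 < f B)
sumSubsets>0 zero    f pos = [] , pos
sumSubsets>0 (suc n) f pos with sumSubsets n (f ∘ (true ∷_)) in eq
... | suc _ = let B , fB>0 = sumSubsets>0 n (f ∘ (true ∷_)) (subst (0 <_) (sym eq) (s≤s z≤n)) in true ∷ B , fB>0
... | zero  = let B , fB>0 = sumSubsets>0 n (f ∘ (false ∷_)) pos in false ∷ B , fB>0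

sumSubsets≡0 : ∀ n (f : Subset n → ℕ) → sumSubsets n f ≡ 0 → ∀ B → f B ≡ 0
sumSubsets≡0 zero    f eq []          = eq
sumSubsets≡0 (suc n) f eq (true ∷ B)  = sumSubsets≡0 n _ (m+n≡0⇒m≡0 _ eq) B
sumSubsets≡0 (suc n) f eq (false ∷ B) = sumSubsets≡0 n _ (m+n≡0⇒n≡0 (sumSubsets n (f ∘ (true ∷_))) eq) B

sumSubsets-≡0 : ∀ n {f : Subset n → ℕ} → (∀ B → f B ≡ 0) → sumSubsets n f ≡ 0
sumSubsets-≡0 zero    f≡0 = f≡0 []
sumSubsets-≡0 (suc n) f≡0 = cong₂ _+_ (sumSubsets-≡0 n (f≡0 ∘ (true ∷_))) (sumSubsets-≡0 n (f≡0 ∘ (false ∷_)))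

∁-involutive : (B : Subset n) → ∁ (∁ B) ≡ B
∁-involutive []          = refl
∁-involutive (true ∷ B)  = cong (true ∷_) (∁-involutive B)
∁-involutive (false ∷ B) = cong (false ∷_) (∁-involutive B)

toggle : Fin n → Subset n → Subset n
toggle Fin.zero    (x ∷ B) = not x ∷ B
toggle (Fin.suc i) (x ∷ B) = x ∷ toggle i B

toggle-involutive : (i : Fin n) (B : Subset n) → toggle i (toggle i B) ≡ B
toggle-involutive Fin.zero    (true ∷ B)  = refl
toggle-involutive Fin.zero    (false ∷ B) = refl
toggle-involutive (Fin.suc i) (x ∷ B)     = cong (x ∷_) (toggle-involutive i B)

sumSubsets-toggle : ∀ n (i : Fin n) (f : Subset n → ℕ) → sumSubsets n (f ∘ toggle i) ≡ sumSubsets n f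
sumSubsets-toggle (suc n) Fin.zero    f = +-comm (sumSubsets n (f ∘ (false ∷_))) _
sumSubsets-toggle (suc n) (Fin.suc i) f =
  cong₂ _+_ (sumSubsets-toggle n i (f ∘ (true ∷_))) (sumSubsets-toggle n i (f ∘ (false ∷_)))

-- Subset sums

subSum-∁ : (A : Vec ℕ n) (B : Subset n) → subSum A B + subSum A (∁ B) ≡ total A
subSum-∁ []      []          = refl
subSum-∁ (a ∷ A) (true ∷ B)  = trans (+-assoc a _ _) (cong (a +_) (subSum-∁ A B))
subSum-∁ (a ∷ A) (false ∷ B) = trans (x+[a+y]≡a+[x+y] (subSum A B) a _) (cong (a +_) (subSum-∁ A B))
  where
  x+[a+y]≡a+[x+y] : ∀ x a y → x + (a + y) ≡ a + (x + y)
  x+[a+y]≡a+[x+y] = solve-∀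

subSum-⊤ : (A : Vec ℕ n) → subSum A ⊤ ≡ total A
subSum-⊤ []      = refl
subSum-⊤ (a ∷ A) = cong (a +_) (subSum-⊤ A)

subSum-∅ : (A : Vec ℕ n) → subSum A ∅ ≡ 0
subSum-∅ []      = refl
subSum-∅ (a ∷ A) = subSum-∅ A

subSum-∁⊤ : (A : Vec ℕ n) → subSum A (∁ ⊤) ≡ 0
subSum-∁⊤ []      = refl
subSum-∁⊤ (a ∷ A) = subSum-∁⊤ A

subSum-⁅⁆ : (A : Vec ℕ n) (i : Fin n) → subSum A ⁅ i ⁆ ≡ lookup A i
subSum-⁅⁆ (a ∷ A) Fin.zero    = trans (cong (a +_) (subSum-∅ A)) (+-identityʳ a)
subSum-⁅⁆ (a ∷ A) (Fin.suc i) = subSum-⁅⁆ A i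

subSum≤total : (A : Vec ℕ n) (B : Subset n) → subSum A B ≤ total A
subSum≤total []      []          = z≤n
subSum≤total (a ∷ A) (true ∷ B)  = +-monoʳ-≤ a (subSum≤total A B)
subSum≤total (a ∷ A) (false ∷ B) = ≤-trans (subSum≤total A B) (m≤n+m _ a)

lookup≤subSum : (A : Vec ℕ n) {B : Subset n} {i : Fin n} → i ∈ B → lookup A i ≤ subSum A B
lookup≤subSum (a ∷ A) {true ∷ B} here        = m≤m+n a _
lookup≤subSum (a ∷ A) {true ∷ B} (there i∈B)  = ≤-trans (lookup≤subSum A i∈B) (m≤n+m _ a)
lookup≤subSum (a ∷ A) {false ∷ B} (there i∈B) = lookup≤subSum A i∈B

subSum+lookup≤total : (A : Vec ℕ n) (B : Subset n) {i : Fin n} → i ∉ B → subSum A B + lookup A i ≤ total A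
subSum+lookup≤total (a ∷ A) (true ∷ B)  {Fin.zero}  i∉B = contradiction here i∉B
subSum+lookup≤total (a ∷ A) (false ∷ B) {Fin.zero}  _   = ≤-trans (≤-reflexive (+-comm _ a)) (+-monoʳ-≤ a (subSum≤total A B))
subSum+lookup≤total (a ∷ A) (true ∷ B)  {Fin.suc i} i∉B =
  ≤-trans (≤-reflexive (+-assoc a _ _)) (+-monoʳ-≤ a (subSum+lookup≤total A B (i∉B ∘ there)))
subSum+lookup≤total (a ∷ A) (false ∷ B) {Fin.suc i} i∉B =
  ≤-trans (subSum+lookup≤total A B (i∉B ∘ there)) (m≤n+m _ a)

subSum-toggle-∈ : (A : Vec ℕ n) (B : Subset n) {i : Fin n} → i ∈ B → subSum A (toggle i B) + lookup A i ≡ subSum A B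
subSum-toggle-∈ (a ∷ A) (true ∷ B)  here        = +-comm (subSum A B) a
subSum-toggle-∈ (a ∷ A) (true ∷ B)  (there i∈B) = trans (+-assoc a _ _) (cong (a +_) (subSum-toggle-∈ A B i∈B))
subSum-toggle-∈ (a ∷ A) (false ∷ B) (there i∈B) = subSum-toggle-∈ A B i∈B

subSum-toggle-∉ : (A : Vec ℕ n) (B : Subset n) {i : Fin n} → i ∉ B → subSum A (toggle i B) ≡ subSum A B + lookup A i
subSum-toggle-∉ (a ∷ A) (true ∷ B)  {Fin.zero}  i∉B = contradiction here i∉B
subSum-toggle-∉ (a ∷ A) (false ∷ B) {Fin.zero}  _   = +-comm a (subSum A B)
subSum-toggle-∉ (a ∷ A) (true ∷ B)  {Fin.suc i} i∉B =
  trans (cong (a +_) (subSum-toggle-∉ A B (i∉B ∘ there))) (sym (+-assoc a _ _))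
subSum-toggle-∉ (a ∷ A) (false ∷ B) {Fin.suc i} i∉B = subSum-toggle-∉ A B (i∉B ∘ there)

subSum>0⇒Nonempty : (A : Vec ℕ n) (B : Subset n) → 0 < subSum A B → Nonempty B
subSum>0⇒Nonempty []      []          ()
subSum>0⇒Nonempty (a ∷ A) (true ∷ B)  _   = Fin.zero , here
subSum>0⇒Nonempty (a ∷ A) (false ∷ B) pos = let i , i∈B = subSum>0⇒Nonempty A B pos in Fin.suc i , there i∈B

≢⊤⇒∃∉ : (B : Subset n) → B ≢ ⊤ → ∃[ i ] (i ∉ B)
≢⊤⇒∃∉ []          B≢⊤ = contradiction refl B≢⊤
≢⊤⇒∃∉ (false ∷ B) _   = Fin.zero , λ ()
≢⊤⇒∃∉ (true ∷ B)  B≢⊤ =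
  let i , i∉B = ≢⊤⇒∃∉ B (B≢⊤ ∘ cong (true ∷_)) in Fin.suc i , λ { (there i∈B) → i∉B i∈B }

Nonempty⇒∁≢⊤ : (B : Subset n) → Nonempty B → ∁ B ≢ ⊤
Nonempty⇒∁≢⊤ B (j , j∈B) ∁B≡⊤ = x∈p⇒x∉∁p j∈B (subst (j ∈_) (sym ∁B≡⊤) ∈⊤)

∁≡⊤⇒sum≡0 : (A : Vec ℕ n) → ∀ B → ∁ B ≡ ⊤ → subSum A B ≡ 0
∁≡⊤⇒sum≡0 A B ∁B≡⊤ = trans (cong (subSum A) (trans (sym (∁-involutive B)) (cong ∁ ∁B≡⊤))) (subSum-∁⊤ A)

total>0 : (A : Vec ℕ (suc m)) → IsPosSet A → 0 < total A
total>0 (a ∷ A) (pos , _) = ≤-trans (pos Fin.zero) (m≤m+n a (total A))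

ascending : (A : Vec ℕ n) → IsPosSet A → ∀ i j → {T (toℕ i <ᵇ toℕ j)} → lookup A i < lookup A j
ascending A (_ , inc) i j {i<j} = inc i j (<ᵇ⇒< (toℕ i) (toℕ j) i<j)

below-last : (A : Vec ℕ (suc m)) → IsPosSet A → ∀ i → i ≢ fromℕ m → lookup A i < lookup A (fromℕ m)
below-last {m} A (_ , inc) i i≢last = inc i (fromℕ m) (subst (toℕ i <_) (sym (toℕ-fromℕ m)) i<m)
  where
  i<m : toℕ i < m
  i<m with m≤n⇒m<n∨m≡n (≤-pred (toℕ<n i))
  ... | inj₁ i<m = i<m
  ... | inj₂ i≡m = contradiction (toℕ-injective (trans i≡m (sym (toℕ-fromℕ m)))) i≢last

-- Divisibility

∣⇒[1+k]*m≤n : ∀ k {m n} → m ∣ n → k * m < n → suc k * m ≤ n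
∣⇒[1+k]*m≤n k {m} (divides q refl) k*m<q*m = *-monoˡ-≤ m (*-cancelʳ-< m k q k*m<q*m)

k*m<n<[1+k]*m⇒m∤n : ∀ k {m n} → k * m < n → n < suc k * m → ¬ m ∣ n
k*m<n<[1+k]*m⇒m∤n k lo hi m∣n = <⇒≱ hi (∣⇒[1+k]*m≤n k m∣n lo)

∣∧k*m<n<[2+k]*m⇒[1+k]*m≡n : ∀ k {m n} → m ∣ n → k * m < n → n < suc (suc k) * m → suc k * m ≡ n
∣∧k*m<n<[2+k]*m⇒[1+k]*m≡n k {m} {n} m∣n lo hi with suc k * m <? n
... | yes gt = contradiction m∣n (k*m<n<[1+k]*m⇒m∤n (suc k) gt hi)
... | no ≯  = ≤-antisym (∣⇒[1+k]*m≤n k m∣n lo) (≮⇒≥ ≯)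

1*m<n : ∀ {m n} → m < n → 1 * m < n
1*m<n {m} = subst (_< _) (sym (*-identityˡ m))

m<n<2m⇒m∤n : ∀ {m n} → m < n → n < 2 * m → ¬ m ∣ n
m<n<2m⇒m∤n lo = k*m<n<[1+k]*m⇒m∤n 1 (1*m<n lo)

m∣n∧m<n⇒2m≤n : ∀ {m n} → m ∣ n → m < n → 2 * m ≤ n
m∣n∧m<n⇒2m≤n m∣n m<n = ∣⇒[1+k]*m≤n 1 m∣n (1*m<n m<n)

m∣n∧n<3m<2n⇒2m≡n : ∀ {m n} → m ∣ n → n < 3 * m → 3 * m < 2 * n → 2 * m ≡ n
m∣n∧n<3m<2n⇒2m≡n {m} {n} m∣n lo hi = ∣∧k*m<n<[2+k]*m⇒[1+k]*m≡n 1 m∣n (1*m<n m<n) lo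
  where
  m<n : m < n
  m<n = *-cancelˡ-< 3 m n (<-≤-trans hi (*-monoˡ-≤ n (≤ᵇ⇒≤ 2 3 _)))

∣⇒>0 : ∀ {m n} → 0 < n → m ∣ n → 0 < m
∣⇒>0 {zero}  0<n 0∣n = contradiction (0∣⇒≡0 0∣n) (>⇒≢ 0<n)
∣⇒>0 {suc _} _   _   = s≤s z≤n

complementary-divisors⇒2s≡n : ∀ {s t n} → s ∣ n → t ∣ n → s + t ≡ n → 0 < n → 2 * s ≡ n
complementary-divisors⇒2s≡n {s} {t} {n} s∣n t∣n s+t≡n 0<n = ≤-antisym 2s≤n n≤2s
  where
  2s≤n : 2 * s ≤ n
  2s≤n = m∣n∧m<n⇒2m≤n s∣n (subst (s <_) s+t≡n (m<m+n s (∣⇒>0 0<n t∣n)))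
  2t≤n : 2 * t ≤ n
  2t≤n = m∣n∧m<n⇒2m≤n t∣n (subst (t <_) (trans (+-comm t s) s+t≡n) (m<m+n t (∣⇒>0 0<n s∣n)))
  [s+t]+[s+t]≡2s+2t : ∀ s t → (s + t) + (s + t) ≡ 2 * s + 2 * t
  [s+t]+[s+t]≡2s+2t = solve-∀
  n≤2s : n ≤ 2 * s
  n≤2s = +-cancelʳ-≤ n n (2 * s) (begin
    n + n           ≡⟨ cong₂ _+_ (sym s+t≡n) (sym s+t≡n) ⟩
    (s + t) + (s + t) ≡⟨ [s+t]+[s+t]≡2s+2t s t ⟩
    2 * s + 2 * t   ≤⟨ +-monoʳ-≤ (2 * s) 2t≤n ⟩
    2 * s + n       ∎)
    where open ≤-Reasoning

halving⇒h>0 : ∀ {h S} → 0 < S → 2 * h ≡ S → 0 < h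
halving⇒h>0 {zero}  0<S 0≡S = contradiction (sym 0≡S) (>⇒≢ 0<S)
halving⇒h>0 {suc _} _   _   = s≤s z≤n

middle-third-complement : ∀ {s s' S} → s + s' ≡ S → S < 3 * s → 3 * s < 2 * S → S < 3 * s' × 3 * s' < 2 * S
middle-third-complement {s} {s'} {S} s+s'≡S S<3s 3s<2S =
  +-cancelˡ-< (3 * s) S (3 * s') (begin-strict
    3 * s + S         <⟨ +-monoˡ-< S 3s<2S ⟩
    2 * S + S         ≡⟨ 3S≡3s+3s' ⟩
    3 * s + 3 * s'    ∎) ,
  +-cancelʳ-< S (3 * s') (2 * S) (begin-strict
    3 * s' + S        <⟨ +-monoʳ-< (3 * s') S<3s ⟩
    3 * s' + 3 * s    ≡⟨ +-comm (3 * s') (3 * s) ⟩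
    3 * s + 3 * s'    ≡⟨ 3S≡3s+3s' ⟨
    2 * S + S         ∎)
  where
  open ≤-Reasoning
  distrib : ∀ s s' → 2 * (s + s') + (s + s') ≡ 3 * s + 3 * s'
  distrib = solve-∀
  3S≡3s+3s' : 2 * S + S ≡ 3 * s + 3 * s'
  3S≡3s+3s' = subst (λ S → 2 * S + S ≡ 3 * s + 3 * s') s+s'≡S (distrib s s')

-- Complementary pairs of divisors

divisor? : (A : Vec ℕ n) (B : Subset n) → Dec (IsDivisor A B)
divisor? A B = subSum A B ∣? total A

d≡sumSubsets : (A : Vec ℕ n) → d A ≡ sumSubsets n (𝟙 ∘ divisor? A)
d≡sumSubsets {n} A = trans (length-filter≡sum-𝟙 (divisor? A) (allSubsets n)) (sum-map-allSubsets n _)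

d≤sumSubsets : (A : Vec ℕ n) (g : Subset n → ℕ) → (∀ B → 𝟙 (divisor? A B) ≤ g B) → d A ≤ sumSubsets n g
d≤sumSubsets {n} A g le = subst (_≤ sumSubsets n g) (sym (d≡sumSubsets A)) (sumSubsets-mono-≤ n le)

¬divisor⇒≤0 : (A : Vec ℕ n) (B : Subset n) → ¬ IsDivisor A B → 𝟙 (divisor? A B) ≤ 0
¬divisor⇒≤0 A B ¬p = ≤-reflexive (𝟙-no (divisor? A B) ¬p)

⊤-divisor : (A : Vec ℕ n) → IsDivisor A ⊤
⊤-divisor A = subst (_∣ total A) (sym (subSum-⊤ A)) ∣-refl

sum≡0⇒¬divisor : (A : Vec ℕ n) → 0 < total A → ∀ B → subSum A B ≡ 0 → ¬ IsDivisor A B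
sum≡0⇒¬divisor A 0<S B s≡0 s∣S = >⇒≢ (∣⇒>0 0<S s∣S) s≡0

sum≡0⇒∁-divisor : (A : Vec ℕ n) → ∀ B → subSum A B ≡ 0 → IsDivisor A (∁ B)
sum≡0⇒∁-divisor A B s≡0 = subst (_∣ total A) (sym (trans (cong (_+ subSum A (∁ B)) (sym s≡0)) (subSum-∁ A B))) ∣-refl

heavier⇒¬divisor : (A : Vec ℕ n) (B : Subset n) → 0 < subSum A (∁ B) → subSum A (∁ B) < subSum A B → ¬ IsDivisor A B
heavier⇒¬divisor A B 0<s' s'<s = subst (λ S → ¬ subSum A B ∣ S) (subSum-∁ A B)
  (m<n<2m⇒m∤n (m<m+n (subSum A B) 0<s')
    (+-monoʳ-< (subSum A B) (subst (subSum A (∁ B) <_) (sym (+-identityʳ (subSum A B))) s'<s)))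

bothDivide : Vec ℕ n → Subset n → ℕ
bothDivide A B = 𝟙 (divisor? A B ×-dec divisor? A (∁ B))

neitherDivides : Vec ℕ n → Subset n → ℕ
neitherDivides A B = 𝟙 (¬? (divisor? A B) ×-dec ¬? (divisor? A (∁ B)))

bothCount : Vec ℕ n → ℕ
bothCount {n} A = sumSubsets n (bothDivide A)

neitherCount : Vec ℕ n → ℕ
neitherCount {n} A = sumSubsets n (neitherDivides A)

d-pairing : (A : Vec ℕ n) → d A + d A + neitherCount A ≡ 2 ^ n + bothCount A
d-pairing {n} A = begin
  d A + d A + neitherCount A
    ≡⟨ cong (λ t → t + t + neitherCount A) (d≡sumSubsets A) ⟩
  Σ f + Σ f + neitherCount A
    ≡⟨ cong (λ t → Σ f + t + neitherCount A) (sym (sumSubsets-∁ n f)) ⟩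
  Σ f + Σ (f ∘ ∁) + neitherCount A
    ≡⟨ cong (_+ neitherCount A) (sym (sumSubsets-+ n f (f ∘ ∁))) ⟩
  Σ (λ B → f B + f (∁ B)) + neitherCount A
    ≡⟨ sym (sumSubsets-+ n _ (neitherDivides A)) ⟩
  Σ (λ B → f B + f (∁ B) + neitherDivides A B)
    ≡⟨ sumSubsets-cong n (λ B → 𝟙-pair (divisor? A B) (divisor? A (∁ B))) ⟩
  Σ (λ B → 1 + bothDivide A B)
    ≡⟨ sumSubsets-+ n (λ _ → 1) (bothDivide A) ⟩
  Σ (λ _ → 1) + bothCount A
    ≡⟨ cong (_+ bothCount A) (sumSubsets-1 n) ⟩
  2 ^ n + bothCount A ∎
  where
  open ≡-Reasoning
  Σ : (Subset n → ℕ) → ℕ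
  Σ = sumSubsets n
  f : Subset n → ℕ
  f = 𝟙 ∘ divisor? A

d-pairingᵐ : (A : Vec ℕ (suc m)) → (d A + d A) + neitherCount A ≡ (2 ^ m + 2 ^ m) + bothCount A
d-pairingᵐ {m} A = trans (d-pairing A) (cong (λ t → 2 ^ m + t + bothCount A) (+-identityʳ (2 ^ m)))

both≤neither⇒d≤2^m : (A : Vec ℕ (suc m)) → bothCount A ≤ neitherCount A → d A ≤ 2 ^ m
both≤neither⇒d≤2^m {m} A both≤neither = *-cancelˡ-≤ 2 (subst₂ _≤_ (double (d A)) (double (2 ^ m)) 2d≤2^[1+m])
  where
  double : ∀ x → x + x ≡ 2 * x
  double x = cong (x +_) (sym (+-identityʳ x))
  2d≤2^[1+m] : d A + d A ≤ 2 ^ m + 2 ^ m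
  2d≤2^[1+m] = +-cancelʳ-≤ (neitherCount A) _ _ (begin
    d A + d A + neitherCount A       ≡⟨ d-pairingᵐ A ⟩
    2 ^ m + 2 ^ m + bothCount A      ≤⟨ +-monoʳ-≤ (2 ^ m + 2 ^ m) both≤neither ⟩
    2 ^ m + 2 ^ m + neitherCount A   ∎)
    where open ≤-Reasoning

both≡0⇒d≤2^m : (A : Vec ℕ (suc m)) → bothCount A ≡ 0 → d A ≤ 2 ^ m
both≡0⇒d≤2^m A both≡0 = both≤neither⇒d≤2^m A (subst (_≤ neitherCount A) (sym both≡0) z≤n)

d≡2^m⇒both≡neither : (A : Vec ℕ (suc m)) → d A ≡ 2 ^ m → bothCount A ≡ neitherCount A
d≡2^m⇒both≡neither {m} A d≡2^m = sym (+-cancelˡ-≡ (2 ^ m + 2 ^ m) _ _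
  (trans (cong (λ t → t + t + neitherCount A) (sym d≡2^m)) (d-pairingᵐ A)))

halving⇒sum≡sum∁ : (A : Vec ℕ n) (B : Subset n) → 2 * subSum A B ≡ total A → subSum A B ≡ subSum A (∁ B)
halving⇒sum≡sum∁ A B 2s≡S = +-cancelˡ-≡ (subSum A B) _ _
  (trans (cong (subSum A B +_) (sym (+-identityʳ (subSum A B)))) (trans 2s≡S (sym (subSum-∁ A B))))

halving⇒divisors : (A : Vec ℕ n) (B : Subset n) → 2 * subSum A B ≡ total A → IsDivisor A B × IsDivisor A (∁ B)
halving⇒divisors A B 2s≡S =
  divides 2 (sym 2s≡S) , divides 2 (sym (trans (cong (2 *_) (sym (halving⇒sum≡sum∁ A B 2s≡S))) 2s≡S))

bothDivide⇒halving : (A : Vec ℕ n) (B : Subset n) → 0 < total A → bothDivide A B ≡ 1 → 2 * subSum A B ≡ total A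
bothDivide⇒halving A B 0<S both = let p , q = 𝟙≡1⇒ (divisor? A B ×-dec divisor? A (∁ B)) both in
  complementary-divisors⇒2s≡n p q (subSum-∁ A B) 0<S

bothCount≡0⊎halving : (A : Vec ℕ n) → 0 < total A → bothCount A ≡ 0 ⊎ ∃[ B ] (2 * subSum A B ≡ total A)
bothCount≡0⊎halving {n} A 0<S with bothCount A in eq
... | zero  = inj₁ refl
... | suc _ = let B , pos = sumSubsets>0 n (bothDivide A) (subst (0 <_) (sym eq) (s≤s z≤n)) in
  inj₂ (B , bothDivide⇒halving A B 0<S (≤-antisym (𝟙≤1 _) pos))

no-halving⇒both≡0 : (A : Vec ℕ n) → 0 < total A → (∀ B → 2 * subSum A B ≢ total A) → bothCount A ≡ 0
no-halving⇒both≡0 A 0<S no-halving with bothCount≡0⊎halving A 0<S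
... | inj₁ both≡0       = both≡0
... | inj₂ (B , 2s≡S) = contradiction 2s≡S (no-halving B)

ExactlyOneOfEachPair : Vec ℕ n → Set
ExactlyOneOfEachPair A =
  ∀ B → (IsDivisor A B → ¬ IsDivisor A (∁ B)) × (¬ IsDivisor A B → IsDivisor A (∁ B))

exactlyOne⇒d≡2^m : (A : Vec ℕ (suc m)) → ExactlyOneOfEachPair A → d A ≡ 2 ^ m
exactlyOne⇒d≡2^m {m} A one = *-cancelˡ-≡ (d A) (2 ^ m) 2 (begin
  2 * d A                           ≡⟨ cong (d A +_) (+-identityʳ (d A)) ⟩
  d A + d A                         ≡⟨ +-identityʳ (d A + d A) ⟨
  d A + d A + 0                     ≡⟨ cong (d A + d A +_) neither≡0 ⟨
  d A + d A + neitherCount A        ≡⟨ d-pairing A ⟩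
  2 ^ suc m + bothCount A           ≡⟨ cong (2 ^ suc m +_) both≡0 ⟩
  2 ^ suc m + 0                     ≡⟨ +-identityʳ (2 ^ suc m) ⟩
  2 * 2 ^ m                         ∎)
  where
  open ≡-Reasoning
  both≡0 : bothCount A ≡ 0
  both≡0 = sumSubsets-≡0 (suc m) λ B →
    𝟙-no (divisor? A B ×-dec divisor? A (∁ B)) λ (p , q) → proj₁ (one B) p q
  neither≡0 : neitherCount A ≡ 0
  neither≡0 = sumSubsets-≡0 (suc m) λ B →
    𝟙-no (¬? (divisor? A B) ×-dec ¬? (divisor? A (∁ B))) λ (¬p , ¬q) → ¬q (proj₂ (one B) ¬p)

d≡2^m∧both≡0⇒exactlyOne : (A : Vec ℕ (suc m)) → d A ≡ 2 ^ m → bothCount A ≡ 0 → ExactlyOneOfEachPair A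
d≡2^m∧both≡0⇒exactlyOne {m} A d≡2^m both≡0 B =
  (λ p q → 𝟙≡0⇒¬ (divisor? A B ×-dec divisor? A (∁ B)) (sumSubsets≡0 (suc m) (bothDivide A) both≡0 B) (p , q)) ,
  (λ ¬p → decidable-stable (divisor? A (∁ B)) λ ¬q →
     𝟙≡0⇒¬ (¬? (divisor? A B) ×-dec ¬? (divisor? A (∁ B))) (neither≡0 B) (¬p , ¬q))
  where
  neither≡0 : ∀ B → neitherDivides A B ≡ 0
  neither≡0 = sumSubsets≡0 (suc m) (neitherDivides A) (trans (sym (d≡2^m⇒both≡neither A d≡2^m)) both≡0)

-- Good elements

-- s = h ± x, stated without truncated subtraction.
OffHalfBy : ℕ → ℕ → ℕ → Set
OffHalfBy h x s = s ≡ h + x ⊎ s + x ≡ h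

offHalfBy-complement : ∀ {h x s s'} → s + s' ≡ h + h → OffHalfBy h x s → OffHalfBy h x s'
offHalfBy-complement {h} {x} {s} {s'} s+s'≡2h (inj₁ s≡h+x) = inj₂ (+-cancelˡ-≡ h _ _ (begin
  h + (s' + x)   ≡⟨ shuffle h s' x ⟩
  (h + x) + s'   ≡⟨ cong (_+ s') s≡h+x ⟨
  s + s'         ≡⟨ s+s'≡2h ⟩
  h + h          ∎))
  where
  open ≡-Reasoning
  shuffle : ∀ h s' x → h + (s' + x) ≡ (h + x) + s'
  shuffle = solve-∀
offHalfBy-complement {h} {x} {s} {s'} s+s'≡2h (inj₂ s+x≡h) = inj₁ (+-cancelˡ-≡ s _ _ (begin
  s + s'         ≡⟨ s+s'≡2h ⟩
  h + h          ≡⟨ cong (h +_) s+x≡h ⟨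
  h + (s + x)    ≡⟨ shuffle h s x ⟩
  s + (h + x)    ∎))
  where
  open ≡-Reasoning
  shuffle : ∀ h s x → h + (s + x) ≡ s + (h + x)
  shuffle = solve-∀

offHalfBy-injective : ∀ {h x y s} → 0 < x → 0 < y → OffHalfBy h x s → OffHalfBy h y s → x ≡ y
offHalfBy-injective {h} _ _ (inj₁ s≡h+x) (inj₁ s≡h+y) = +-cancelˡ-≡ h _ _ (trans (sym s≡h+x) s≡h+y)
offHalfBy-injective {s = s} _ _ (inj₂ s+x≡h) (inj₂ s+y≡h) = +-cancelˡ-≡ s _ _ (trans s+x≡h (sym s+y≡h))
offHalfBy-injective {h} {x} {y} {s} 0<x _ (inj₁ s≡h+x) (inj₂ s+y≡h) =
  contradiction (trans (cong (_+ y) (sym s≡h+x)) s+y≡h) (>⇒≢ (≤-trans (m<m+n h 0<x) (m≤m+n (h + x) y)))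
offHalfBy-injective {h} {x} {y} {s} _ 0<y (inj₂ s+x≡h) (inj₁ s≡h+y) =
  contradiction (trans (cong (_+ x) (sym s≡h+y)) s+x≡h) (>⇒≢ (≤-trans (m<m+n h 0<y) (m≤m+n (h + y) x)))

toggle-halving⇒offHalfBy : (A : Vec ℕ n) (B : Subset n) (c : Fin n) {h : ℕ} → 2 * h ≡ total A →
  2 * subSum A (toggle c B) ≡ total A → OffHalfBy h (lookup A c) (subSum A B)
toggle-halving⇒offHalfBy A B c {h} 2h≡S 2t≡S with c ∈? B
... | yes c∈B = inj₁ (trans (sym (subSum-toggle-∈ A B c∈B)) (cong (_+ lookup A c) t≡h))
  where t≡h = *-cancelˡ-≡ _ h 2 (trans 2t≡S (sym 2h≡S))
... | no  c∉B = inj₂ (trans (sym (subSum-toggle-∉ A B c∉B)) t≡h)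
  where t≡h = *-cancelˡ-≡ _ h 2 (trans 2t≡S (sym 2h≡S))

-- Used with h + h = ∑A, where it makes the sums h ± x non-divisors.
Good : Vec ℕ n → ℕ → Fin n → Set
Good A h c = lookup A c < h × ¬ (h ∸ lookup A c) ∣ total A

good? : (A : Vec ℕ n) (h : ℕ) (c : Fin n) → Dec (Good A h c)
good? A h c = (lookup A c <? h) ×-dec ¬? ((h ∸ lookup A c) ∣? total A)

good⇒offHalfBy⇒∤ : (A : Vec ℕ n) {h : ℕ} (c : Fin n) → 2 * h ≡ total A → 0 < lookup A c → Good A h c →
  ∀ {s} → OffHalfBy h (lookup A c) s → ¬ s ∣ total A
good⇒offHalfBy⇒∤ A {h} c 2h≡S 0<x (x<h , h∸x∤S) (inj₁ refl) =
  subst (λ S → ¬ (h + lookup A c) ∣ S) 2h≡S (m<n<2m⇒m∤n h+x<2h 2h<2[h+x])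
  where
  h+x<2h : h + lookup A c < 2 * h
  h+x<2h = subst (h + lookup A c <_) (cong (h +_) (sym (+-identityʳ h))) (+-monoʳ-< h x<h)
  2h<2[h+x] : 2 * h < 2 * (h + lookup A c)
  2h<2[h+x] = *-monoʳ-< 2 (m<m+n h 0<x)
good⇒offHalfBy⇒∤ A {h} c 2h≡S 0<x (x<h , h∸x∤S) {s} (inj₂ s+x≡h) =
  subst (λ t → ¬ t ∣ total A) (trans (cong (_∸ lookup A c) (sym s+x≡h)) (m+n∸n≡m s (lookup A c))) h∸x∤S

good⇒offHalfBy⇒neither : (A : Vec ℕ n) (B : Subset n) {h : ℕ} (c : Fin n) → 2 * h ≡ total A → 0 < lookup A c →
  Good A h c → OffHalfBy h (lookup A c) (subSum A B) → ¬ IsDivisor A B × ¬ IsDivisor A (∁ B)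
good⇒offHalfBy⇒neither A B {h} c 2h≡S 0<x good off =
  good⇒offHalfBy⇒∤ A c 2h≡S 0<x good off ,
  good⇒offHalfBy⇒∤ A c 2h≡S 0<x good (offHalfBy-complement s+s'≡2h off)
  where
  s+s'≡2h : subSum A B + subSum A (∁ B) ≡ h + h
  s+s'≡2h = trans (subSum-∁ A B) (trans (sym 2h≡S) (cong (h +_) (+-identityʳ h)))

divisors∘toggle⇒offHalfBy : (A : Vec ℕ n) (B : Subset n) {h : ℕ} (c : Fin n) → 0 < total A → 2 * h ≡ total A →
  IsDivisor A (toggle c B) × IsDivisor A (∁ (toggle c B)) → OffHalfBy h (lookup A c) (subSum A B)
divisors∘toggle⇒offHalfBy A B c 0<S 2h≡S (p , q) =
  toggle-halving⇒offHalfBy A B c 2h≡S (complementary-divisors⇒2s≡n p q (subSum-∁ A (toggle c B)) 0<S)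

good⇒both∘toggle≤neither : (A : Vec ℕ n) {h : ℕ} (c : Fin n) → 0 < total A → 2 * h ≡ total A → 0 < lookup A c →
  Good A h c → ∀ B → bothDivide A (toggle c B) ≤ neitherDivides A B
good⇒both∘toggle≤neither A c 0<S 2h≡S 0<x good B = 𝟙-mono _ _
  (good⇒offHalfBy⇒neither A B c 2h≡S 0<x good ∘ divisors∘toggle⇒offHalfBy A B c 0<S 2h≡S)

good⇒both≤neither : (A : Vec ℕ n) {h : ℕ} (c : Fin n) → 0 < total A → 2 * h ≡ total A → 0 < lookup A c →
  Good A h c → bothCount A ≤ neitherCount A
good⇒both≤neither {n} A c 0<S 2h≡S 0<x good =
  subst (_≤ neitherCount A) (sumSubsets-toggle n c (bothDivide A))
    (sumSubsets-mono-≤ n (good⇒both∘toggle≤neither A c 0<S 2h≡S 0<x good))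

two-goods⇒both<neither : (A : Vec ℕ n) {h : ℕ} (c₁ c₂ : Fin n) → 0 < total A → 2 * h ≡ total A →
  0 < lookup A c₁ → 0 < lookup A c₂ → lookup A c₁ ≢ lookup A c₂ → Good A h c₁ → Good A h c₂ →
  (P : Subset n) → 2 * subSum A P ≡ total A → bothCount A < neitherCount A
two-goods⇒both<neither {n} A c₁ c₂ 0<S 2h≡S 0<x₁ 0<x₂ x₁≢x₂ good₁ good₂ P 2p≡S =
  subst (_< neitherCount A) (sumSubsets-toggle n c₁ (bothDivide A))
    (sumSubsets-mono-< n (good⇒both∘toggle≤neither A c₁ 0<S 2h≡S 0<x₁ good₁) B₀
      (subst₂ _<_ (sym both≡0) (sym neither≡1) (s≤s z≤n)))
  where
  B₀ : Subset n
  B₀ = toggle c₂ P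
  off₂ : OffHalfBy _ (lookup A c₂) (subSum A B₀)
  off₂ = toggle-halving⇒offHalfBy A B₀ c₂ 2h≡S (subst (λ B → 2 * subSum A B ≡ total A) (sym (toggle-involutive c₂ P)) 2p≡S)
  neither≡1 : neitherDivides A B₀ ≡ 1
  neither≡1 = 𝟙-yes _ (good⇒offHalfBy⇒neither A B₀ c₂ 2h≡S 0<x₂ good₂ off₂)
  both≡0 : bothDivide A (toggle c₁ B₀) ≡ 0
  both≡0 = 𝟙-no _ λ divs → x₁≢x₂ (offHalfBy-injective 0<x₁ 0<x₂ (divisors∘toggle⇒offHalfBy A B₀ c₁ 0<S 2h≡S divs) off₂)

-- The possible shapes of an element x that is not good for the half h: writing 2h = q (h - x) with q ≥ 3 gives
-- q x = (q - 2) h, i.e. one of the cases q = 3, 4, 5 and q ≥ 6 below.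
Rigid : ℕ → ℕ → Set
Rigid x h = 3 * x ≡ h ⊎ 2 * x ≡ h ⊎ 5 * x ≡ 3 * h ⊎ 2 * h ≤ 3 * x

cancel-via : ∀ {a b c e} → a + c ≡ b + e → c ≡ e → a ≡ b
cancel-via {a} {b} {c} a+c≡b+c refl = +-cancelʳ-≡ c a b a+c≡b+c

q≤2⇒2[x+y]≢q*y : ∀ {q x y} → q ≤ 2 → 0 < x → 2 * (x + y) ≢ q * y
q≤2⇒2[x+y]≢q*y {q} {x} {y} q≤2 0<x = >⇒≢ (≤-<-trans (*-monoˡ-≤ y q≤2) (*-monoʳ-< 2 (m<n+m y 0<x)))

cofactor⇒rigid : ∀ q {x y} → 0 < x → 2 * (x + y) ≡ q * y → Rigid x (x + y)
cofactor⇒rigid 0 0<x eq = contradiction eq (q≤2⇒2[x+y]≢q*y z≤n 0<x)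
cofactor⇒rigid 1 0<x eq = contradiction eq (q≤2⇒2[x+y]≢q*y (≤ᵇ⇒≤ 1 2 _) 0<x)
cofactor⇒rigid 2 0<x eq = contradiction eq (q≤2⇒2[x+y]≢q*y ≤-refl 0<x)
cofactor⇒rigid 3 {x} {y} _ eq = inj₁ (cancel-via (identity x y) (sym eq))
  where
  identity : ∀ x y → 3 * x + 3 * y ≡ (x + y) + 2 * (x + y)
  identity = solve-∀
cofactor⇒rigid 4 {x} {y} _ eq = inj₂ (inj₁ (*-cancelˡ-≡ _ _ 2 (cancel-via (identity x y) (sym eq))))
  where
  identity : ∀ x y → 2 * (2 * x) + 4 * y ≡ 2 * (x + y) + 2 * (x + y)
  identity = solve-∀
cofactor⇒rigid 5 {x} {y} _ eq = inj₂ (inj₂ (inj₁ (cancel-via (identity x y) (sym eq))))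
  where
  identity : ∀ x y → 5 * x + 5 * y ≡ 3 * (x + y) + 2 * (x + y)
  identity = solve-∀
cofactor⇒rigid (suc (suc (suc (suc (suc (suc k)))))) {x} {y} _ eq = inj₂ (inj₂ (inj₂ (begin
  2 * (x + y)     ≡⟨ distrib x y ⟩
  2 * x + 2 * y   ≤⟨ +-monoʳ-≤ (2 * x) (*-cancelˡ-≤ 2 4y≤2x) ⟩
  2 * x + x       ≡⟨ +-comm (2 * x) x ⟩
  3 * x           ∎)))
  where
  open ≤-Reasoning
  distrib : ∀ x y → 2 * (x + y) ≡ 2 * x + 2 * y
  distrib = solve-∀
  expand : ∀ k y → (6 + k) * y ≡ 2 * (2 * y) + (2 * y + k * y)
  expand = solve-∀
  4y≤2x : 2 * (2 * y) ≤ 2 * x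
  4y≤2x = +-cancelʳ-≤ (2 * y) _ _ (begin
    2 * (2 * y) + 2 * y             ≤⟨ +-monoʳ-≤ (2 * (2 * y)) (m≤m+n (2 * y) (k * y)) ⟩
    2 * (2 * y) + (2 * y + k * y)   ≡⟨ expand k y ⟨
    (6 + k) * y                     ≡⟨ eq ⟨
    2 * (x + y)                     ≡⟨ distrib x y ⟩
    2 * x + 2 * y                   ∎)

¬good⇒rigid : ∀ {x h S} → 0 < x → 2 * h ≡ S → ¬ (x < h × ¬ (h ∸ x) ∣ S) → Rigid x h
¬good⇒rigid {x} {h} {S} 0<x 2h≡S ¬good with x <? h
... | no x≮h = inj₂ (inj₂ (inj₂ (≤-trans (*-monoʳ-≤ 2 (≮⇒≥ x≮h)) (*-monoˡ-≤ x (≤ᵇ⇒≤ 2 3 _)))))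
... | yes x<h with (h ∸ x) ∣? S
...   | no h∸x∤S = contradiction (x<h , h∸x∤S) ¬good
...   | yes (divides q S≡q*[h∸x]) =
  subst (Rigid x) x+[h∸x]≡h (cofactor⇒rigid q 0<x (trans (cong (2 *_) x+[h∸x]≡h) (trans 2h≡S S≡q*[h∸x])))
  where
  x+[h∸x]≡h : x + (h ∸ x) ≡ h
  x+[h∸x]≡h = m+[n∸m]≡n (<⇒≤ x<h)

rigid⇒h≤3x : ∀ {x h} → Rigid x h → h ≤ 3 * x
rigid⇒h≤3x (inj₁ 3x≡h) = ≤-reflexive (sym 3x≡h)
rigid⇒h≤3x {x} (inj₂ (inj₁ 2x≡h)) = subst (_≤ 3 * x) 2x≡h (*-monoˡ-≤ x (≤ᵇ⇒≤ 2 3 _))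
rigid⇒h≤3x {x} {h} (inj₂ (inj₂ (inj₁ 5x≡3h))) = *-cancelˡ-≤ 3 (begin
  3 * h         ≡⟨ 5x≡3h ⟨
  5 * x         ≤⟨ *-monoˡ-≤ x (≤ᵇ⇒≤ 5 9 _) ⟩
  9 * x         ≡⟨ *-assoc 3 3 x ⟩
  3 * (3 * x)   ∎)
  where open ≤-Reasoning
rigid⇒h≤3x {x} {h} (inj₂ (inj₂ (inj₂ 2h≤3x))) = ≤-trans (m≤m+n h (h + 0)) 2h≤3x

rigid∧h<3x⇒h≤2x : ∀ {x h} → Rigid x h → h < 3 * x → h ≤ 2 * x
rigid∧h<3x⇒h≤2x (inj₁ 3x≡h) h<3x = contradiction (sym 3x≡h) (<⇒≢ h<3x)
rigid∧h<3x⇒h≤2x (inj₂ (inj₁ 2x≡h)) _ = ≤-reflexive (sym 2x≡h)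
rigid∧h<3x⇒h≤2x {x} {h} (inj₂ (inj₂ (inj₁ 5x≡3h))) _ = *-cancelˡ-≤ 3 (begin
  3 * h         ≡⟨ 5x≡3h ⟨
  5 * x         ≤⟨ *-monoˡ-≤ x (≤ᵇ⇒≤ 5 6 _) ⟩
  6 * x         ≡⟨ *-assoc 3 2 x ⟩
  3 * (2 * x)   ∎)
  where open ≤-Reasoning
rigid∧h<3x⇒h≤2x {x} {h} (inj₂ (inj₂ (inj₂ 2h≤3x))) _ = *-cancelˡ-≤ 2 (begin
  2 * h         ≤⟨ 2h≤3x ⟩
  3 * x         ≤⟨ *-monoˡ-≤ x (≤ᵇ⇒≤ 3 4 _) ⟩
  4 * x         ≡⟨ *-assoc 2 2 x ⟩
  2 * (2 * x)   ∎)
  where open ≤-Reasoning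

rigid∧h<2x⇒3h≤5x : ∀ {x h} → Rigid x h → h < 2 * x → 3 * h ≤ 5 * x
rigid∧h<2x⇒3h≤5x {x} (inj₁ 3x≡h) h<2x = contradiction (subst (2 * x ≤_) 3x≡h (*-monoˡ-≤ x (≤ᵇ⇒≤ 2 3 _))) (<⇒≱ h<2x)
rigid∧h<2x⇒3h≤5x (inj₂ (inj₁ 2x≡h)) h<2x = contradiction (sym 2x≡h) (<⇒≢ h<2x)
rigid∧h<2x⇒3h≤5x (inj₂ (inj₂ (inj₁ 5x≡3h))) _ = ≤-reflexive (sym 5x≡3h)
rigid∧h<2x⇒3h≤5x {x} {h} (inj₂ (inj₂ (inj₂ 2h≤3x))) _ = *-cancelˡ-≤ 2 (begin
  2 * (3 * h)   ≡⟨ *-assoc 2 3 h ⟨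
  6 * h         ≡⟨ *-assoc 3 2 h ⟩
  3 * (2 * h)   ≤⟨ *-monoʳ-≤ 3 2h≤3x ⟩
  3 * (3 * x)   ≡⟨ *-assoc 3 3 x ⟨
  9 * x         ≤⟨ *-monoˡ-≤ x (≤ᵇ⇒≤ 9 10 _) ⟩
  10 * x        ≡⟨ *-assoc 2 5 x ⟩
  2 * (5 * x)   ∎)
  where open ≤-Reasoning

rigid∧3h<5x⇒2h≤3x : ∀ {x h} → Rigid x h → 3 * h < 5 * x → 2 * h ≤ 3 * x
rigid∧3h<5x⇒2h≤3x {x} {h} (inj₁ 3x≡h) 3h<5x = contradiction (begin
  5 * x         ≤⟨ *-monoˡ-≤ x (≤ᵇ⇒≤ 5 9 _) ⟩
  9 * x         ≡⟨ *-assoc 3 3 x ⟩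
  3 * (3 * x)   ≡⟨ cong (3 *_) 3x≡h ⟩
  3 * h         ∎) (<⇒≱ 3h<5x)
  where open ≤-Reasoning
rigid∧3h<5x⇒2h≤3x {x} {h} (inj₂ (inj₁ 2x≡h)) 3h<5x = contradiction (begin
  5 * x         ≤⟨ *-monoˡ-≤ x (≤ᵇ⇒≤ 5 6 _) ⟩
  6 * x         ≡⟨ *-assoc 3 2 x ⟩
  3 * (2 * x)   ≡⟨ cong (3 *_) 2x≡h ⟩
  3 * h         ∎) (<⇒≱ 3h<5x)
  where open ≤-Reasoning
rigid∧3h<5x⇒2h≤3x (inj₂ (inj₂ (inj₁ 5x≡3h))) 3h<5x = contradiction (sym 5x≡3h) (<⇒≢ 3h<5x)
rigid∧3h<5x⇒2h≤3x (inj₂ (inj₂ (inj₂ 2h≤3x))) _ = 2h≤3x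

-- Chaining the four bounds: 63 h ≤ 10·3x₁ + 15·2x₂ + 6·5x₃ + 10·3x₄ = 30 (x₁ + x₂ + x₃ + x₄).
no-four-rigid : ∀ {x₁ x₂ x₃ x₄ h} → 0 < h → Rigid x₁ h → Rigid x₂ h → Rigid x₃ h → Rigid x₄ h →
  x₁ < x₂ → x₂ < x₃ → x₃ < x₄ → x₁ + x₂ + x₃ + x₄ ≤ 2 * h → ⊥
no-four-rigid {x₁} {x₂} {x₃} {x₄} {h} 0<h r₁ r₂ r₃ r₄ x₁<x₂ x₂<x₃ x₃<x₄ sum≤2h =
  <⇒≱ (*-monoˡ-< h {60} {63} (≤ᵇ⇒≤ 61 63 _)) (begin
    63 * h                                                      ≡⟨ weights h ⟩
    10 * h + 15 * h + 6 * (3 * h) + 10 * (2 * h)                 ≤⟨ weighted-bounds ⟩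
    10 * (3 * x₁) + 15 * (2 * x₂) + 6 * (5 * x₃) + 10 * (3 * x₄) ≡⟨ collect x₁ x₂ x₃ x₄ ⟩
    30 * (x₁ + x₂ + x₃ + x₄)                                     ≤⟨ *-monoʳ-≤ 30 sum≤2h ⟩
    30 * (2 * h)                                                 ≡⟨ *-assoc 30 2 h ⟨
    60 * h                                                       ∎)
  where
  open ≤-Reasoning
  instance _ = >-nonZero 0<h
  b₁ : h ≤ 3 * x₁
  b₁ = rigid⇒h≤3x {x₁} r₁
  b₂ : h ≤ 2 * x₂
  b₂ = rigid∧h<3x⇒h≤2x {x₂} r₂ (≤-<-trans b₁ (*-monoʳ-< 3 x₁<x₂))
  b₃ : 3 * h ≤ 5 * x₃
  b₃ = rigid∧h<2x⇒3h≤5x {x₃} r₃ (≤-<-trans b₂ (*-monoʳ-< 2 x₂<x₃))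
  b₄ : 2 * h ≤ 3 * x₄
  b₄ = rigid∧3h<5x⇒2h≤3x {x₄} r₄ (≤-<-trans b₃ (*-monoʳ-< 5 x₃<x₄))
  weighted-bounds : 10 * h + 15 * h + 6 * (3 * h) + 10 * (2 * h) ≤ 10 * (3 * x₁) + 15 * (2 * x₂) + 6 * (5 * x₃) + 10 * (3 * x₄)
  weighted-bounds = +-mono-≤ (+-mono-≤ (+-mono-≤ (*-monoʳ-≤ 10 b₁) (*-monoʳ-≤ 15 b₂)) (*-monoʳ-≤ 6 b₃)) (*-monoʳ-≤ 10 b₄)
  weights : ∀ h → 63 * h ≡ 10 * h + 15 * h + 6 * (3 * h) + 10 * (2 * h)
  weights = solve-∀
  collect : ∀ x₁ x₂ x₃ x₄ → 10 * (3 * x₁) + 15 * (2 * x₂) + 6 * (5 * x₃) + 10 * (3 * x₄) ≡ 30 * (x₁ + x₂ + x₃ + x₄)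
  collect = solve-∀

module GoodElements {n} (A : Vec ℕ n) {h : ℕ} (0<h : 0 < h) (2h≡S : 2 * h ≡ total A)
                    (pos : ∀ i → 0 < lookup A i) where

  fourth-good : ∀ i j k l → ¬ Good A h i → ¬ Good A h j → ¬ Good A h k →
    lookup A i < lookup A j → lookup A j < lookup A k → lookup A k < lookup A l →
    lookup A i + lookup A j + lookup A k + lookup A l ≤ 2 * h → Good A h l
  fourth-good i j k l ¬gᵢ ¬gⱼ ¬gₖ xᵢ<xⱼ xⱼ<xₖ xₖ<xₗ sum≤2h with good? A h l
  ... | yes gₗ = gₗ
  ... | no ¬gₗ = ⊥-elim (no-four-rigid 0<h (rigid i ¬gᵢ) (rigid j ¬gⱼ) (rigid k ¬gₖ) (rigid l ¬gₗ) xᵢ<xⱼ xⱼ<xₖ xₖ<xₗ sum≤2h)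
    where
    rigid : ∀ c → ¬ Good A h c → Rigid (lookup A c) h
    rigid c = ¬good⇒rigid (pos c) 2h≡S

  some-good-among-four : ∀ i j k l → lookup A i < lookup A j → lookup A j < lookup A k → lookup A k < lookup A l →
    lookup A i + lookup A j + lookup A k + lookup A l ≤ 2 * h → ∃[ c ] Good A h c
  some-good-among-four i j k l xᵢ<xⱼ xⱼ<xₖ xₖ<xₗ sum≤2h with good? A h i | good? A h j | good? A h k
  ... | yes gᵢ | _      | _      = i , gᵢ
  ... | no _   | yes gⱼ | _      = j , gⱼ
  ... | no _   | no _   | yes gₖ = k , gₖ
  ... | no ¬gᵢ | no ¬gⱼ | no ¬gₖ = l , fourth-good i j k l ¬gᵢ ¬gⱼ ¬gₖ xᵢ<xⱼ xⱼ<xₖ xₖ<xₗ sum≤2h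

  -- If four of the five were not good they would contradict no-four-rigid.
  two-goods-among-five : ∀ i₀ i₁ i₂ i₃ i₄ → let x = lookup A in
    x i₀ < x i₁ → x i₁ < x i₂ → x i₂ < x i₃ → x i₃ < x i₄ →
    x i₀ + x i₁ + x i₂ + x i₃ + x i₄ ≤ 2 * h →
    ∃[ c ] ∃[ c' ] (Good A h c × Good A h c' × x c < x c')
  two-goods-among-five i₀ i₁ i₂ i₃ i₄ x₀<x₁ x₁<x₂ x₂<x₃ x₃<x₄ sum≤2h =
    go (good? A h i₀) (good? A h i₁) (good? A h i₂) (good? A h i₃)
    where
    x₀ x₁ x₂ x₃ x₄ : ℕ
    x₀ = lookup A i₀
    x₁ = lookup A i₁
    x₂ = lookup A i₂
    x₃ = lookup A i₃
    x₄ = lookup A i₄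
    x₀<x₂ : x₀ < x₂
    x₀<x₂ = <-trans x₀<x₁ x₁<x₂
    x₁<x₃ : x₁ < x₃
    x₁<x₃ = <-trans x₁<x₂ x₂<x₃
    x₂<x₄ : x₂ < x₄
    x₂<x₄ = <-trans x₂<x₃ x₃<x₄
    x₀<x₃ : x₀ < x₃
    x₀<x₃ = <-trans x₀<x₂ x₂<x₃
    x₁<x₄ : x₁ < x₄
    x₁<x₄ = <-trans x₁<x₃ x₃<x₄
    x₀<x₄ : x₀ < x₄
    x₀<x₄ = <-trans x₀<x₃ x₃<x₄
    drop : ∀ s t → s + t ≡ x₀ + x₁ + x₂ + x₃ + x₄ → s ≤ 2 * h
    drop s t eq = ≤-trans (m≤m+n s t) (subst (_≤ 2 * h) (sym eq) sum≤2h)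
    drop₀ : ∀ a b c e f → (b + c + e + f) + a ≡ a + b + c + e + f
    drop₀ = solve-∀
    drop₁ : ∀ a b c e f → (a + c + e + f) + b ≡ a + b + c + e + f
    drop₁ = solve-∀
    drop₂ : ∀ a b c e f → (a + b + e + f) + c ≡ a + b + c + e + f
    drop₂ = solve-∀
    drop₃ : ∀ a b c e f → (a + b + c + f) + e ≡ a + b + c + e + f
    drop₃ = solve-∀
    go : Dec (Good A h i₀) → Dec (Good A h i₁) → Dec (Good A h i₂) → Dec (Good A h i₃) →
      ∃[ c ] ∃[ c' ] (Good A h c × Good A h c' × lookup A c < lookup A c')
    go (yes g₀) (yes g₁) _        _        = i₀ , i₁ , g₀ , g₁ , x₀<x₁
    go (yes g₀) (no _)   (yes g₂) _        = i₀ , i₂ , g₀ , g₂ , x₀<x₂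
    go (yes g₀) (no _)   (no _)   (yes g₃) = i₀ , i₃ , g₀ , g₃ , x₀<x₃
    go (yes g₀) (no ¬g₁) (no ¬g₂) (no ¬g₃) = i₀ , i₄ , g₀ ,
      fourth-good i₁ i₂ i₃ i₄ ¬g₁ ¬g₂ ¬g₃ x₁<x₂ x₂<x₃ x₃<x₄ (drop _ x₀ (drop₀ x₀ x₁ x₂ x₃ x₄)) , x₀<x₄
    go (no _)   (yes g₁) (yes g₂) _        = i₁ , i₂ , g₁ , g₂ , x₁<x₂
    go (no _)   (yes g₁) (no _)   (yes g₃) = i₁ , i₃ , g₁ , g₃ , x₁<x₃
    go (no ¬g₀) (yes g₁) (no ¬g₂) (no ¬g₃) = i₁ , i₄ , g₁ ,
      fourth-good i₀ i₂ i₃ i₄ ¬g₀ ¬g₂ ¬g₃ x₀<x₂ x₂<x₃ x₃<x₄ (drop _ x₁ (drop₁ x₀ x₁ x₂ x₃ x₄)) , x₁<x₄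
    go (no _)   (no _)   (yes g₂) (yes g₃) = i₂ , i₃ , g₂ , g₃ , x₂<x₃
    go (no ¬g₀) (no ¬g₁) (yes g₂) (no ¬g₃) = i₂ , i₄ , g₂ ,
      fourth-good i₀ i₁ i₃ i₄ ¬g₀ ¬g₁ ¬g₃ x₀<x₁ x₁<x₃ x₃<x₄ (drop _ x₂ (drop₂ x₀ x₁ x₂ x₃ x₄)) , x₂<x₄
    go (no ¬g₀) (no ¬g₁) (no ¬g₂) (yes g₃) = i₃ , i₄ , g₃ ,
      fourth-good i₀ i₁ i₂ i₄ ¬g₀ ¬g₁ ¬g₂ x₀<x₁ x₁<x₂ x₂<x₄ (drop _ x₃ (drop₃ x₀ x₁ x₂ x₃ x₄)) , x₃<x₄
    go (no ¬g₀) (no ¬g₁) (no ¬g₂) (no ¬g₃) = ⊥-elim (¬g₃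
      (fourth-good i₀ i₁ i₂ i₃ ¬g₀ ¬g₁ ¬g₂ x₀<x₁ x₁<x₂ x₂<x₃ (drop _ x₄ refl)))

d≤2^m-of-≥4 : ∀ k (A : Vec ℕ (4 + k)) → IsPosSet A → d A ≤ 2 ^ (3 + k)
d≤2^m-of-≥4 k A@(a₀ ∷ a₁ ∷ a₂ ∷ a₃ ∷ rest) ip@(pos , _) with bothCount≡0⊎halving A (total>0 A ip)
... | inj₁ both≡0 = both≡0⇒d≤2^m A both≡0
... | inj₂ (P , 2h≡S) =
  let c , good = some-good-among-four (# 0) (# 1) (# 2) (# 3)
                   (ascending A ip (# 0) (# 1)) (ascending A ip (# 1) (# 2)) (ascending A ip (# 2) (# 3)) first-four≤2h
  in both≤neither⇒d≤2^m A (good⇒both≤neither A c 0<S 2h≡S (pos c) good)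
  where
  0<S : 0 < total A
  0<S = total>0 A ip
  open GoodElements A {subSum A P} (halving⇒h>0 0<S 2h≡S) 2h≡S pos
  regroup : ∀ a₀ a₁ a₂ a₃ t → (a₀ + a₁ + a₂ + a₃) + t ≡ a₀ + (a₁ + (a₂ + (a₃ + t)))
  regroup = solve-∀
  first-four≤2h : a₀ + a₁ + a₂ + a₃ ≤ 2 * subSum A P
  first-four≤2h = subst (a₀ + a₁ + a₂ + a₃ ≤_) (trans (regroup a₀ a₁ a₂ a₃ (total rest)) (sym 2h≡S)) (m≤m+n _ (total rest))

d≡2^m⇒both≡0-of-≥5 : ∀ k (A : Vec ℕ (5 + k)) → IsPosSet A → d A ≡ 2 ^ (4 + k) → bothCount A ≡ 0
d≡2^m⇒both≡0-of-≥5 k A@(a₀ ∷ a₁ ∷ a₂ ∷ a₃ ∷ a₄ ∷ rest) ip@(pos , _) d≡2^m with bothCount≡0⊎halving A (total>0 A ip)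
... | inj₁ both≡0 = both≡0
... | inj₂ (P , 2h≡S) =
  let c , c' , good , good' , x<x' = two-goods-among-five (# 0) (# 1) (# 2) (# 3) (# 4)
        (ascending A ip (# 0) (# 1)) (ascending A ip (# 1) (# 2)) (ascending A ip (# 2) (# 3)) (ascending A ip (# 3) (# 4))
        first-five≤2h
  in contradiction (d≡2^m⇒both≡neither A d≡2^m)
       (<⇒≢ (two-goods⇒both<neither A c c' 0<S 2h≡S (pos c) (pos c') (<⇒≢ x<x') good good' P 2h≡S))
  where
  0<S : 0 < total A
  0<S = total>0 A ip
  open GoodElements A {subSum A P} (halving⇒h>0 0<S 2h≡S) 2h≡S pos
  regroup : ∀ a₀ a₁ a₂ a₃ a₄ t → (a₀ + a₁ + a₂ + a₃ + a₄) + t ≡ a₀ + (a₁ + (a₂ + (a₃ + (a₄ + t))))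
  regroup = solve-∀
  first-five≤2h : a₀ + a₁ + a₂ + a₃ + a₄ ≤ 2 * subSum A P
  first-five≤2h = subst (a₀ + a₁ + a₂ + a₃ + a₄ ≤_) (trans (regroup a₀ a₁ a₂ a₃ a₄ (total rest)) (sym 2h≡S))
                    (m≤m+n _ (total rest))

-- Anti-pencils

-- Greedy scan keeping the largest element in reserve: every other element is below S/3, so the first time the
-- running sum (plus the reserve) passes S/3 it lands strictly inside the middle third.
middle-third-subset : ∀ m (A : Vec ℕ (suc m)) {S} b → 0 < S → b + total A ≡ S →
  3 * (b + lookup A (fromℕ m)) ≤ S → (∀ i → i ≢ fromℕ m → 3 * lookup A i < S) →
  ∃[ B ] (S < 3 * (b + subSum A B) × 3 * (b + subSum A B) < 2 * S)
middle-third-subset zero (y ∷ []) {S} b 0<S b+y≡S 3[b+y]≤S _ = contradiction 3S≤S (<⇒≱ S<3S)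
  where
  3S≤S : 3 * S ≤ S
  3S≤S = subst (λ t → 3 * t ≤ S) (trans (cong (b +_) (sym (+-identityʳ y))) b+y≡S) 3[b+y]≤S
  S<3S : S < 3 * S
  S<3S = m<m+n S (≤-trans 0<S (m≤m+n S _))
middle-third-subset (suc m) (x ∷ A) {S} b 0<S b+x+A≡S 3[b+ℓ]≤S small with 3 * (b + x + lookup A (fromℕ m)) ≤? S
... | yes 3[b+x+ℓ]≤S =
  let B , lo , hi = middle-third-subset m A (b + x) 0<S (trans (+-assoc b x (total A)) b+x+A≡S) 3[b+x+ℓ]≤S
                      (λ i i≢ℓ → small (Fin.suc i) (i≢ℓ ∘ Fin-suc-injective))
  in true ∷ B , subst (λ t → S < 3 * t) (+-assoc b x _) lo , subst (λ t → 3 * t < 2 * S) (+-assoc b x _) hi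
... | no 3[b+x+ℓ]≰S =
  true ∷ ⁅ fromℕ m ⁆ ,
  subst (λ t → S < 3 * t) (sym b+x+⁅ℓ⁆≡b+x+ℓ) (≰⇒> 3[b+x+ℓ]≰S) ,
  subst (λ t → 3 * t < 2 * S) (sym b+x+⁅ℓ⁆≡b+x+ℓ) (begin-strict
    3 * (b + x + ℓ)       ≡⟨ distrib b x ℓ ⟩
    3 * (b + ℓ) + 3 * x   <⟨ +-mono-≤-< 3[b+ℓ]≤S (small Fin.zero λ ()) ⟩
    S + S                 ≡⟨ cong (S +_) (+-identityʳ S) ⟨
    2 * S                 ∎)
  where
  open ≤-Reasoning
  ℓ : ℕ
  ℓ = lookup A (fromℕ m)
  b+x+⁅ℓ⁆≡b+x+ℓ : b + (x + subSum A ⁅ fromℕ m ⁆) ≡ b + x + ℓ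
  b+x+⁅ℓ⁆≡b+x+ℓ = trans (cong (λ t → b + (x + t)) (subSum-⁅⁆ A (fromℕ m))) (sym (+-assoc b x ℓ))
  distrib : ∀ b x ℓ → 3 * (b + x + ℓ) ≡ 3 * (b + ℓ) + 3 * x
  distrib = solve-∀

exactlyOne⇒no-halving : (A : Vec ℕ n) → ExactlyOneOfEachPair A → ∀ B → 2 * subSum A B ≢ total A
exactlyOne⇒no-halving A one B 2s≡S = let p , q = halving⇒divisors A B 2s≡S in proj₁ (one B) p q

exactlyOne⇒no-middle-third : (A : Vec ℕ n) → ExactlyOneOfEachPair A → ∀ B →
  total A < 3 * subSum A B → 3 * subSum A B < 2 * total A → ⊥
exactlyOne⇒no-middle-third A one B lo hi with divisor? A B
... | yes p = exactlyOne⇒no-halving A one B (m∣n∧n<3m<2n⇒2m≡n p lo hi)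
... | no ¬p = let lo' , hi' = middle-third-complement {subSum A B} {subSum A (∁ B)} (subSum-∁ A B) lo hi in
  exactlyOne⇒no-halving A one (∁ B) (m∣n∧n<3m<2n⇒2m≡n (proj₂ (one B) ¬p) lo' hi')

exactlyOne∧last∈⇒¬divisor : (A : Vec ℕ (suc m)) → IsPosSet A → ExactlyOneOfEachPair A →
  ∀ B → fromℕ m ∈ B → B ≢ ⊤ → ¬ IsDivisor A B
exactlyOne∧last∈⇒¬divisor {m} A ip one B ℓ∈B B≢⊤ s∣S =
  let B' , lo , hi = middle-third-subset m A 0 0<S refl 3ℓ≤S
                       (λ i i≢ℓ → <-≤-trans (*-monoʳ-< 3 (below-last A ip i i≢ℓ)) 3ℓ≤S)
  in exactlyOne⇒no-middle-third A one B' lo hi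
  where
  S s : ℕ
  S = total A
  s = subSum A B
  0<S : 0 < S
  0<S = total>0 A ip
  s<S : s < S
  s<S = let j , j∉B = ≢⊤⇒∃∉ B B≢⊤ in <-≤-trans (m<m+n s (proj₁ ip j)) (subSum+lookup≤total A B j∉B)
  2s<S : 2 * s < S
  2s<S = ≤∧≢⇒< (m∣n∧m<n⇒2m≤n s∣S s<S) (exactlyOne⇒no-halving A one B)
  3ℓ≤S : 3 * (0 + lookup A (fromℕ m)) ≤ S
  3ℓ≤S = ≤-trans (*-monoʳ-≤ 3 (lookup≤subSum A ℓ∈B)) (∣⇒[1+k]*m≤n 2 s∣S 2s<S)

exactlyOne⇒antiPencil : (A : Vec ℕ (suc m)) → IsPosSet A → ExactlyOneOfEachPair A → AntiPencil A
exactlyOne⇒antiPencil {m} A ip one B = mk⇔ to from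
  where
  to : IsDivisor A B → (Nonempty B × fromℕ m ∉ B) ⊎ B ≡ ⊤
  to p with ≡-dec Bool._≟_ B ⊤
  ... | yes B≡⊤ = inj₂ B≡⊤
  ... | no  B≢⊤ = inj₁ (subSum>0⇒Nonempty A B (∣⇒>0 (total>0 A ip) p) ,
                        λ ℓ∈B → exactlyOne∧last∈⇒¬divisor A ip one B ℓ∈B B≢⊤ p)
  from : (Nonempty B × fromℕ m ∉ B) ⊎ B ≡ ⊤ → IsDivisor A B
  from (inj₂ refl)         = ⊤-divisor A
  from (inj₁ (ne , ℓ∉B)) = decidable-stable (divisor? A B) λ ¬p →
    exactlyOne∧last∈⇒¬divisor A ip one (∁ B) (x∉p⇒x∈∁p ℓ∉B) (Nonempty⇒∁≢⊤ B ne) (proj₂ (one B) ¬p)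

antiPencil⇒exactlyOne : (A : Vec ℕ (suc m)) → IsPosSet A → AntiPencil A → ExactlyOneOfEachPair A
antiPencil⇒exactlyOne {m} A ip ap B with fromℕ m ∈? B
... | yes ℓ∈B = p⇒¬q , ¬p⇒q
  where
  p⇒¬q : IsDivisor A B → ¬ IsDivisor A (∁ B)
  p⇒¬q p with Equivalence.to (ap B) p
  ... | inj₁ (_ , ℓ∉B) = contradiction ℓ∈B ℓ∉B
  ... | inj₂ refl      = sum≡0⇒¬divisor A (total>0 A ip) (∁ ⊤) (subSum-∁⊤ A)
  ¬p⇒q : ¬ IsDivisor A B → IsDivisor A (∁ B)
  ¬p⇒q ¬p = let j , j∉B = ≢⊤⇒∃∉ B (λ { refl → ¬p (⊤-divisor A) }) in
    Equivalence.from (ap (∁ B)) (inj₁ ((j , x∉p⇒x∈∁p j∉B) , x∈p⇒x∉∁p ℓ∈B))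
... | no ℓ∉B = p⇒¬q , ¬p⇒q
  where
  p⇒¬q : IsDivisor A B → ¬ IsDivisor A (∁ B)
  p⇒¬q p q with Equivalence.to (ap (∁ B)) q
  ... | inj₁ (_ , ℓ∉∁B) = ℓ∉∁B (x∉p⇒x∈∁p ℓ∉B)
  ... | inj₂ ∁B≡⊤       = sum≡0⇒¬divisor A (total>0 A ip) B (∁≡⊤⇒sum≡0 A B ∁B≡⊤) p
  ¬p⇒q : ¬ IsDivisor A B → IsDivisor A (∁ B)
  ¬p⇒q ¬p with nonempty? B
  ... | yes ne = contradiction (Equivalence.from (ap B) (inj₁ (ne , ℓ∉B))) ¬p
  ... | no ¬ne = sum≡0⇒∁-divisor A B (trans (cong (subSum A) (Empty-unique ¬ne)) (subSum-∅ A))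

-- The largest element exceeds S/2, so no set containing it (other than A) divides S; every other non-empty set
-- has sum at most S - aₙ and divides S by assumption.
big-last⇒antiPencil : (A : Vec ℕ (suc m)) → IsPosSet A → total A < 2 * lookup A (fromℕ m) →
  (∀ x → 0 < x → x + lookup A (fromℕ m) ≤ total A → x ∣ total A) → AntiPencil A
big-last⇒antiPencil {m} A ip@(pos , _) S<2ℓ small B = mk⇔ to from
  where
  to : IsDivisor A B → (Nonempty B × fromℕ m ∉ B) ⊎ B ≡ ⊤
  to p with ≡-dec Bool._≟_ B ⊤
  ... | yes B≡⊤ = inj₂ B≡⊤
  ... | no  B≢⊤ = inj₁ (subSum>0⇒Nonempty A B (∣⇒>0 (total>0 A ip) p) , λ ℓ∈B → m<n<2m⇒m∤n s<S (S<2s ℓ∈B) p)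
    where
    s<S : subSum A B < total A
    s<S = let j , j∉B = ≢⊤⇒∃∉ B B≢⊤ in <-≤-trans (m<m+n (subSum A B) (pos j)) (subSum+lookup≤total A B j∉B)
    S<2s : fromℕ m ∈ B → total A < 2 * subSum A B
    S<2s ℓ∈B = <-≤-trans S<2ℓ (*-monoʳ-≤ 2 (lookup≤subSum A ℓ∈B))
  from : (Nonempty B × fromℕ m ∉ B) ⊎ B ≡ ⊤ → IsDivisor A B
  from (inj₂ refl)               = ⊤-divisor A
  from (inj₁ ((j , j∈B) , ℓ∉B)) =
    small (subSum A B) (<-≤-trans (pos j) (lookup≤subSum A j∈B)) (subSum+lookup≤total A B ℓ∉B)

consecutiveThen : ℕ → (m : ℕ) → ℕ → Vec ℕ (suc m)
consecutiveThen k zero    M = M ∷ []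
consecutiveThen k (suc m) M = k ∷ consecutiveThen (suc k) m M

consecutiveSum : ℕ → ℕ → ℕ
consecutiveSum k zero    = 0
consecutiveSum k (suc m) = k + consecutiveSum (suc k) m

total-consecutiveThen : ∀ k m M → total (consecutiveThen k m M) ≡ consecutiveSum k m + M
total-consecutiveThen k zero    M = +-identityʳ M
total-consecutiveThen k (suc m) M = trans (cong (k +_) (total-consecutiveThen (suc k) m M)) (sym (+-assoc k _ M))

last-consecutiveThen : ∀ k m M → lookup (consecutiveThen k m M) (fromℕ m) ≡ M
last-consecutiveThen k zero    M = refl
last-consecutiveThen k (suc m) M = last-consecutiveThen (suc k) m M

consecutiveThen-≥ : ∀ k m M → k + m ≤ M → ∀ i → k ≤ lookup (consecutiveThen k m M) i
consecutiveThen-≥ k zero    M k+0≤M Fin.zero    = subst (_≤ M) (+-identityʳ k) k+0≤M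
consecutiveThen-≥ k (suc m) M _     Fin.zero    = ≤-refl
consecutiveThen-≥ k (suc m) M k+m≤M (Fin.suc i) =
  ≤-trans (n≤1+n k) (consecutiveThen-≥ (suc k) m M (subst (_≤ M) (+-suc k m) k+m≤M) i)

consecutiveThen-IsPosSet : ∀ k m M → 0 < k → k + m ≤ M → IsPosSet (consecutiveThen k m M)
consecutiveThen-IsPosSet k m M 0<k k+m≤M = (λ i → <-≤-trans 0<k (consecutiveThen-≥ k m M k+m≤M i)) , ascending′ k m k+m≤M
  where
  ascending′ : ∀ k m → k + m ≤ M → ∀ i j → toℕ i < toℕ j →
    lookup (consecutiveThen k m M) i < lookup (consecutiveThen k m M) j
  ascending′ k (suc m) k+m≤M Fin.zero    (Fin.suc j) _         =
    consecutiveThen-≥ (suc k) m M (subst (_≤ M) (+-suc k m) k+m≤M) j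
  ascending′ k (suc m) k+m≤M (Fin.suc i) (Fin.suc j) (s≤s i<j) =
    ascending′ (suc k) m (subst (_≤ M) (+-suc k m) k+m≤M) i j i<j

m≤consecutiveSum : ∀ k m → 0 < k → m ≤ consecutiveSum k m
m≤consecutiveSum k zero    _   = z≤n
m≤consecutiveSum k (suc m) 0<k = +-mono-≤ 0<k (m≤consecutiveSum (suc k) m (s≤s z≤n))

-- (1, 2, …, m, M) with M = 2 (P + 1)! - P, where P = 1 + 2 + ⋯ + m: the total 2 (P + 1)! is a multiple of every
-- x ≤ P, while M > P.
antiPencil-witness : ∀ m → ∃[ A ] (IsPosSet {suc m} A × AntiPencil A)
antiPencil-witness m = A , ip , big-last⇒antiPencil A ip S<2M small
  where
  P F M : ℕ
  P = consecutiveSum 1 m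
  F = 2 * suc P !
  M = F ∸ P
  P+P<F : P + P < F
  P+P<F = begin-strict
    P + P         <⟨ +-mono-< (n<1+n P) (n<1+n P) ⟩
    suc P + suc P ≡⟨ cong (suc P +_) (+-identityʳ (suc P)) ⟨
    2 * suc P     ≤⟨ *-monoʳ-≤ 2 (subst (_≤ suc P !) (*-identityʳ (suc P)) (*-monoʳ-≤ (suc P) (1≤n! P))) ⟩
    F             ∎
    where open ≤-Reasoning
  P≤F : P ≤ F
  P≤F = ≤-trans (m≤m+n P P) (<⇒≤ P+P<F)
  P<M : P < M
  P<M = +-cancelˡ-< P P M (subst (P + P <_) (sym (m+[n∸m]≡n P≤F)) P+P<F)
  A : Vec ℕ (suc m)
  A = consecutiveThen 1 m M
  ip : IsPosSet A
  ip = consecutiveThen-IsPosSet 1 m M (s≤s z≤n) (≤-trans (s≤s (m≤consecutiveSum 1 m (s≤s z≤n))) P<M)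
  S≡P+M : total A ≡ P + M
  S≡P+M = total-consecutiveThen 1 m M
  S<2M : total A < 2 * lookup A (fromℕ m)
  S<2M = subst₂ (λ S ℓ → S < 2 * ℓ) (sym S≡P+M) (sym (last-consecutiveThen 1 m M))
    (subst (P + M <_) (cong (M +_) (sym (+-identityʳ M))) (+-monoˡ-< M P<M))
  small : ∀ x → 0 < x → x + lookup A (fromℕ m) ≤ total A → x ∣ total A
  small x@(suc y) _ x+ℓ≤S = subst (x ∣_) (trans (sym (m+[n∸m]≡n P≤F)) (sym S≡P+M))
    (∣-trans (m∣m*n (y !)) (∣-trans (m≤n⇒m!∣n! (≤-trans x≤P (n≤1+n P))) (n∣m*n 2)))
    where
    x≤P : x ≤ P
    x≤P = +-cancelʳ-≤ M x P (subst₂ (λ ℓ S → x + ℓ ≤ S) (last-consecutiveThen 1 m M) S≡P+M x+ℓ≤S)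

-- Sets of at most four elements

pattern ● = true
pattern ○ = false

no-halving-of-1 : (A : Vec ℕ 1) → IsPosSet A → ∀ B → 2 * subSum A B ≢ total A
no-halving-of-1 A@(a ∷ []) (pos , _) B 2s≡S with B | halving⇒sum≡sum∁ A B 2s≡S
... | ● ∷ [] | a+0≡0 = >⇒≢ (≤-trans (pos Fin.zero) (m≤m+n a 0)) a+0≡0
... | ○ ∷ [] | 0≡a+0 = <⇒≢ (≤-trans (pos Fin.zero) (m≤m+n a 0)) 0≡a+0

no-halving-of-2 : (A : Vec ℕ 2) → IsPosSet A → ∀ B → 2 * subSum A B ≢ total A
no-halving-of-2 A@(a ∷ b ∷ []) ip@(pos , _) B 2s≡S with B | halving⇒sum≡sum∁ A B 2s≡S
... | ● ∷ ● ∷ [] | a+b≡0 = >⇒≢ (≤-trans (pos Fin.zero) (m≤m+n a _)) a+b≡0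
... | ● ∷ ○ ∷ [] | a≡b   = <⇒≢ (+-monoˡ-< 0 (ascending A ip (# 0) (# 1))) a≡b
... | ○ ∷ ● ∷ [] | b≡a   = >⇒≢ (+-monoˡ-< 0 (ascending A ip (# 0) (# 1))) b≡a
... | ○ ∷ ○ ∷ [] | 0≡a+b = <⇒≢ (≤-trans (pos Fin.zero) (m≤m+n a _)) 0≡a+b

both≡0-of-≤2 : ∀ m → m ≤ 1 → (A : Vec ℕ (suc m)) → IsPosSet A → bothCount A ≡ 0
both≡0-of-≤2 zero          _         A ip = no-halving⇒both≡0 A (total>0 A ip) (no-halving-of-1 A ip)
both≡0-of-≤2 (suc zero)    _         A ip = no-halving⇒both≡0 A (total>0 A ip) (no-halving-of-2 A ip)
both≡0-of-≤2 (suc (suc _)) (s≤s ())  _ _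

scale : ℕ → Vec ℕ n → Vec ℕ n
scale a = Data.Vec.map (_* a)

subSum-scale : ∀ a (A : Vec ℕ n) B → subSum (scale a A) B ≡ subSum A B * a
subSum-scale a []      []          = refl
subSum-scale a (x ∷ A) (true ∷ B)  = trans (cong (x * a +_) (subSum-scale a A B)) (sym (*-distribʳ-+ a x _))
subSum-scale a (x ∷ A) (false ∷ B) = subSum-scale a A B

total-scale : ∀ a (A : Vec ℕ n) → total (scale a A) ≡ total A * a
total-scale a []      = refl
total-scale a (x ∷ A) = trans (cong (x * a +_) (total-scale a A)) (sym (*-distribʳ-+ a x _))

d-scale : ∀ a → 0 < a → (A : Vec ℕ n) → d (scale a A) ≡ d A
d-scale {n} a 0<a A = begin
  d (scale a A)                               ≡⟨ d≡sumSubsets (scale a A) ⟩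
  sumSubsets n (𝟙 ∘ divisor? (scale a A))     ≡⟨ sumSubsets-cong n (λ B → 𝟙-cong _ _ (cancel B) (mono B)) ⟩
  sumSubsets n (𝟙 ∘ divisor? A)               ≡⟨ d≡sumSubsets A ⟨
  d A                                         ∎
  where
  open ≡-Reasoning
  instance _ = >-nonZero 0<a
  cancel : ∀ B → IsDivisor (scale a A) B → IsDivisor A B
  cancel B = *-cancelʳ-∣ a ∘ subst₂ _∣_ (subSum-scale a A B) (total-scale a A)
  mono : ∀ B → IsDivisor A B → IsDivisor (scale a A) B
  mono B = subst₂ _∣_ (sym (subSum-scale a A B)) (sym (total-scale a A)) ∘ *-monoˡ-∣ a

-- By d-scale these reduce to (1, 2, 3) and (1, 2, 3, 6), where d evaluates to 5 and 8.
d-of-a,2a,3a : ∀ a → 0 < a → d (a ∷ 2 * a ∷ 3 * a ∷ []) ≡ 5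
d-of-a,2a,3a a 0<a = trans (cong (λ x → d (x ∷ 2 * a ∷ 3 * a ∷ [])) (sym (*-identityˡ a))) (d-scale a 0<a (1 ∷ 2 ∷ 3 ∷ []))

d-of-a,2a,3a,6a : ∀ a → 0 < a → d (a ∷ 2 * a ∷ 3 * a ∷ 6 * a ∷ []) ≡ 8
d-of-a,2a,3a,6a a 0<a =
  trans (cong (λ x → d (x ∷ 2 * a ∷ 3 * a ∷ 6 * a ∷ [])) (sym (*-identityˡ a))) (d-scale a 0<a (1 ∷ 2 ∷ 3 ∷ 6 ∷ []))

-- c ∣ N with N/3 < c < N forces N = 2c, i.e. c = a + b; then b ∣ 2a + 2b with a < b forces 3b = 2a + 2b.
divisors-of-a+b+c⇒shape : ∀ {a b c} → 0 < a → a < b → b < c → b ∣ a + b + c → c ∣ a + b + c → b ≡ 2 * a × c ≡ 3 * a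
divisors-of-a+b+c⇒shape {a} {b} {c} 0<a a<b b<c b∣N c∣N = b≡2a , c≡3a
  where
  open ≤-Reasoning
  N : ℕ
  N = a + b + c
  2c≡N : 2 * c ≡ N
  2c≡N = ∣∧k*m<n<[2+k]*m⇒[1+k]*m≡n 1 c∣N
    (begin-strict
      1 * c         ≡⟨ *-identityˡ c ⟩
      c             <⟨ m<n+m c (<-≤-trans 0<a (m≤m+n a b)) ⟩
      N             ∎)
    (begin-strict
      N             <⟨ +-mono-<-≤ (+-mono-< (<-trans a<b b<c) b<c) ≤-refl ⟩
      c + c + c     ≡⟨ triple c ⟩
      3 * c         ∎)
    where
    triple : ∀ c → c + c + c ≡ 3 * c
    triple = solve-∀
  c≡a+b : c ≡ a + b
  c≡a+b = +-cancelʳ-≡ c c (a + b) (trans (double c) 2c≡N)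
    where
    double : ∀ c → c + c ≡ 2 * c
    double = solve-∀
  N≡2a+2b : N ≡ 2 * a + 2 * b
  N≡2a+2b = trans (cong (a + b +_) c≡a+b) (expand a b)
    where
    expand : ∀ a b → a + b + (a + b) ≡ 2 * a + 2 * b
    expand = solve-∀
  3b≡N : 3 * b ≡ N
  3b≡N = ∣∧k*m<n<[2+k]*m⇒[1+k]*m≡n 2 b∣N
    (begin-strict
      2 * b           <⟨ m<n+m (2 * b) (*-monoʳ-< 2 0<a) ⟩
      2 * a + 2 * b   ≡⟨ N≡2a+2b ⟨
      N               ∎)
    (begin-strict
      N               ≡⟨ N≡2a+2b ⟩
      2 * a + 2 * b   <⟨ +-monoˡ-< (2 * b) (*-monoʳ-< 2 a<b) ⟩
      2 * b + 2 * b   ≡⟨ *-distribʳ-+ b 2 2 ⟨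
      4 * b           ∎)
  b≡2a : b ≡ 2 * a
  b≡2a = +-cancelˡ-≡ (2 * b) _ _ (trans (split b) (trans 3b≡N (trans N≡2a+2b (+-comm (2 * a) (2 * b)))))
    where
    split : ∀ b → 2 * b + b ≡ 3 * b
    split = solve-∀
  c≡3a : c ≡ 3 * a
  c≡3a = trans c≡a+b (trans (cong (a +_) b≡2a) (collect a))
    where
    collect : ∀ a → a + 2 * a ≡ 3 * a
    collect = solve-∀

module ThreeElements (a b c : ℕ) (0<a : 0 < a) (a<b : a < b) (b<c : b < c) where

  A : Vec ℕ 3
  A = a ∷ b ∷ c ∷ []

  t : Subset 3 → ℕ
  t B = 𝟙 (divisor? A B)

  tᵇ tᶜ : ℕ
  tᵇ = t (○ ∷ ● ∷ ○ ∷ [])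
  tᶜ = t (○ ∷ ○ ∷ ● ∷ [])

  -- A pointwise bound on 𝟙 (divisor? A B): ∅ and the sets heavier than their complement are not divisors.
  bound : Subset 3 → ℕ
  bound (○ ∷ ● ∷ ○ ∷ []) = tᵇ
  bound (○ ∷ ○ ∷ ● ∷ []) = tᶜ
  bound (● ∷ ○ ∷ ● ∷ []) = 0
  bound (○ ∷ ● ∷ ● ∷ []) = 0
  bound (○ ∷ ○ ∷ ○ ∷ []) = 0
  bound _                = 1

  t≤bound : ∀ B → t B ≤ bound B
  t≤bound (● ∷ ● ∷ ● ∷ []) = 𝟙≤1 _
  t≤bound (● ∷ ● ∷ ○ ∷ []) = 𝟙≤1 _
  t≤bound B@(● ∷ ○ ∷ ● ∷ []) = ¬divisor⇒≤0 A B (heavier⇒¬divisor A B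
    (≤-trans (<-trans 0<a a<b) (m≤m+n b 0)) (<-≤-trans (+-monoˡ-< 0 b<c) (m≤n+m (c + 0) a)))
  t≤bound (● ∷ ○ ∷ ○ ∷ []) = 𝟙≤1 _
  t≤bound B@(○ ∷ ● ∷ ● ∷ []) = ¬divisor⇒≤0 A B (heavier⇒¬divisor A B
    (≤-trans 0<a (m≤m+n a 0)) (<-≤-trans (+-monoˡ-< 0 a<b) (+-monoʳ-≤ b z≤n)))
  t≤bound (○ ∷ ● ∷ ○ ∷ []) = ≤-refl
  t≤bound (○ ∷ ○ ∷ ● ∷ []) = ≤-refl
  t≤bound B@(○ ∷ ○ ∷ ○ ∷ []) = ¬divisor⇒≤0 A B (sum≡0⇒¬divisor A (≤-trans 0<a (m≤m+n a _)) B refl)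

  d≤3+tᵇ+tᶜ : d A ≤ 3 + (tᵇ + tᶜ)
  d≤3+tᵇ+tᶜ = ≤-trans (d≤sumSubsets A bound t≤bound) (≤-reflexive (collect tᵇ tᶜ))
    where
    collect : ∀ x y → ((1 + 1) + (0 + 1)) + ((0 + x) + (y + 0)) ≡ 3 + (x + y)
    collect = solve-∀

  d≤5 : d A ≤ 5
  d≤5 = ≤-trans d≤3+tᵇ+tᶜ (+-monoʳ-≤ 3 (+-mono-≤ (𝟙≤1 (divisor? A (○ ∷ ● ∷ ○ ∷ []))) (𝟙≤1 (divisor? A (○ ∷ ○ ∷ ● ∷ [])))))

  d≡5⇒shape : d A ≡ 5 → b ≡ 2 * a × c ≡ 3 * a
  d≡5⇒shape d≡5 =
    let p , q = 𝟙+𝟙≥2 (divisor? A (○ ∷ ● ∷ ○ ∷ [])) (divisor? A (○ ∷ ○ ∷ ● ∷ []))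
                  (+-cancelˡ-≤ 3 _ _ (subst (_≤ 3 + (tᵇ + tᶜ)) d≡5 d≤3+tᵇ+tᶜ))
    in divisors-of-a+b+c⇒shape 0<a a<b b<c (subst₂ _∣_ (+-identityʳ b) S≡a+b+c p) (subst₂ _∣_ (+-identityʳ c) S≡a+b+c q)
    where
    regroup : ∀ a b c → a + (b + (c + 0)) ≡ a + b + c
    regroup = solve-∀
    S≡a+b+c : total A ≡ a + b + c
    S≡a+b+c = regroup a b c

-- With N = 2(a + b + c): a + c ∣ N forces a + c = 2b, so N = 6b; then a + b ∣ 6b leaves (a, b, c) = (a, 2a, 3a) or
-- (a, 5a, 9a), and the latter fails c ∣ N.
divisors-of-2[a+b+c]⇒shape : ∀ {a b c} → 0 < a → a < b → b < c → let N = 2 * a + 2 * b + 2 * c in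
  a + b ∣ N → a + c ∣ N → c ∣ N → b ≡ 2 * a × c ≡ 3 * a
divisors-of-2[a+b+c]⇒shape {a} {b} {c} 0<a a<b b<c a+b∣N a+c∣N c∣N = shape 4y≡6b⊎5y≡6b
  where
  open ≤-Reasoning
  instance _ = >-nonZero 0<a
  N : ℕ
  N = 2 * a + 2 * b + 2 * c
  3[a+c]≡N : 3 * (a + c) ≡ N
  3[a+c]≡N = ∣∧k*m<n<[2+k]*m⇒[1+k]*m≡n 2 a+c∣N
    (begin-strict
      2 * (a + c)             ≡⟨ split a c ⟩
      2 * a + 0 + 2 * c       <⟨ +-monoˡ-< (2 * c) (+-monoʳ-< (2 * a) (*-monoʳ-< 2 (<-trans 0<a a<b))) ⟩
      N                       ∎)
    (begin-strict
      N                       <⟨ +-monoˡ-< (2 * c) (+-monoʳ-< (2 * a) (*-monoʳ-< 2 (<-≤-trans b<c (m≤n+m c a)))) ⟩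
      2 * a + 2 * (a + c) + 2 * c ≡⟨ collect a c ⟩
      4 * (a + c)             ∎)
    where
    split : ∀ a c → 2 * (a + c) ≡ 2 * a + 0 + 2 * c
    split = solve-∀
    collect : ∀ a c → 2 * a + 2 * (a + c) + 2 * c ≡ 4 * (a + c)
    collect = solve-∀
  a+c≡2b : a + c ≡ 2 * b
  a+c≡2b = +-cancelʳ-≡ (2 * (a + c)) _ _ (trans (split a c) (trans 3[a+c]≡N (regroup a b c)))
    where
    split : ∀ a c → (a + c) + 2 * (a + c) ≡ 3 * (a + c)
    split = solve-∀
    regroup : ∀ a b c → 2 * a + 2 * b + 2 * c ≡ 2 * b + 2 * (a + c)
    regroup = solve-∀
  N≡6b : N ≡ 6 * b
  N≡6b = trans (regroup a b c) (trans (cong (λ x → 2 * b + 2 * x) a+c≡2b) (collect b))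
    where
    regroup : ∀ a b c → 2 * a + 2 * b + 2 * c ≡ 2 * b + 2 * (a + c)
    regroup = solve-∀
    collect : ∀ b → 2 * b + 2 * (2 * b) ≡ 6 * b
    collect = solve-∀
  a+b∣6b : a + b ∣ 6 * b
  a+b∣6b = subst (a + b ∣_) N≡6b a+b∣N
  3y<6b : 3 * (a + b) < 6 * b
  3y<6b = begin-strict
    3 * (a + b)     ≡⟨ *-distribˡ-+ 3 a b ⟩
    3 * a + 3 * b   <⟨ +-monoˡ-< (3 * b) (*-monoʳ-< 3 a<b) ⟩
    3 * b + 3 * b   ≡⟨ *-distribʳ-+ b 3 3 ⟨
    6 * b           ∎
  4y≡6b⊎5y≡6b : 4 * (a + b) ≡ 6 * b ⊎ 5 * (a + b) ≡ 6 * b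
  4y≡6b⊎5y≡6b with 4 * (a + b) <? 6 * b
  ... | no  4y≮6b = inj₁ (≤-antisym (∣⇒[1+k]*m≤n 3 a+b∣6b 3y<6b) (≮⇒≥ 4y≮6b))
  ... | yes 4y<6b = inj₂ (∣∧k*m<n<[2+k]*m⇒[1+k]*m≡n 4 a+b∣6b 4y<6b (*-monoʳ-< 6 (m<n+m b 0<a)))
  shape : 4 * (a + b) ≡ 6 * b ⊎ 5 * (a + b) ≡ 6 * b → b ≡ 2 * a × c ≡ 3 * a
  shape (inj₁ 4y≡6b) = b≡2a , +-cancelˡ-≡ a c (3 * a) (trans a+c≡2b (trans (cong (2 *_) b≡2a) (collect a)))
    where
    split : ∀ a b → 4 * (a + b) ≡ 2 * (2 * a) + 4 * b
    split = solve-∀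
    regroup : ∀ b → 6 * b ≡ 2 * b + 4 * b
    regroup = solve-∀
    collect : ∀ a → 2 * (2 * a) ≡ a + 3 * a
    collect = solve-∀
    b≡2a : b ≡ 2 * a
    b≡2a = *-cancelˡ-≡ b (2 * a) 2 (sym (+-cancelʳ-≡ (4 * b) _ _ (trans (sym (split a b)) (trans 4y≡6b (regroup b)))))
  shape (inj₂ 5y≡6b) = contradiction c∣N (k*m<n<[1+k]*m⇒m∤n 3
    (subst₂ _<_ (cong (3 *_) (sym c≡9a)) (sym N≡30a) (subst (_< 30 * a) (*-assoc 3 9 a) (*-monoˡ-< a (≤ᵇ⇒≤ 28 30 _))))
    (subst₂ _<_ (sym N≡30a) (cong (4 *_) (sym c≡9a)) (subst (30 * a <_) (*-assoc 4 9 a) (*-monoˡ-< a (≤ᵇ⇒≤ 31 36 _)))))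
    where
    split : ∀ a b → 5 * (a + b) ≡ 5 * a + 5 * b
    split = solve-∀
    regroup : ∀ b → 6 * b ≡ b + 5 * b
    regroup = solve-∀
    b≡5a : b ≡ 5 * a
    b≡5a = sym (+-cancelʳ-≡ (5 * b) _ _ (trans (sym (split a b)) (trans 5y≡6b (regroup b))))
    collect : ∀ a → 2 * (5 * a) ≡ a + 9 * a
    collect = solve-∀
    c≡9a : c ≡ 9 * a
    c≡9a = +-cancelˡ-≡ a c (9 * a) (trans a+c≡2b (trans (cong (2 *_) b≡5a) (collect a)))
    N≡30a : N ≡ 30 * a
    N≡30a = trans N≡6b (trans (cong (6 *_) b≡5a) (sym (*-assoc 6 5 a)))

module FourElements (a b c e : ℕ) (0<a : 0 < a) (a<b : a < b) (b<c : b < c) (c<e : c < e) where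

  A : Vec ℕ 4
  A = a ∷ b ∷ c ∷ e ∷ []

  S : ℕ
  S = total A

  0<b : 0 < b
  0<b = <-trans 0<a a<b
  0<c : 0 < c
  0<c = <-trans 0<b b<c
  0<S : 0 < S
  0<S = ≤-trans 0<a (m≤m+n a _)

  t : Subset 4 → ℕ
  t B = 𝟙 (divisor? A B)

  a<c : a < c
  a<c = <-trans a<b b<c
  b<e : b < e
  b<e = <-trans b<c c<e

  c<a+b+e : c + 0 < a + (b + (e + 0))
  c<a+b+e = <-≤-trans (+-monoˡ-< 0 c<e) (≤-trans (m≤n+m _ b) (m≤n+m _ a))
  b<a+c+e : b + 0 < a + (c + (e + 0))
  b<a+c+e = <-≤-trans (+-monoˡ-< 0 b<c) (≤-trans (+-monoʳ-≤ c z≤n) (m≤n+m _ a))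
  a<b+c+e : a + 0 < b + (c + (e + 0))
  a<b+c+e = <-≤-trans (+-monoˡ-< 0 a<b) (+-monoʳ-≤ b z≤n)
  a+c<b+e : a + (c + 0) < b + (e + 0)
  a+c<b+e = +-mono-< a<b (+-monoˡ-< 0 c<e)
  a+b<c+e : a + (b + 0) < c + (e + 0)
  a+b<c+e = +-mono-< a<c (+-monoˡ-< 0 b<e)

  halving-shapes-∋a : ∀ x y z → let P = ● ∷ x ∷ y ∷ z ∷ [] in
    subSum A P ≡ subSum A (∁ P) → e ≡ a + b + c ⊎ a + e ≡ b + c
  halving-shapes-∋a ● ● ● S≡0 = contradiction S≡0 (>⇒≢ 0<S)
  halving-shapes-∋a ● ● ○ eq  = inj₁ (trans (sym (+-identityʳ e)) (trans (sym eq) (assoc a b c)))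
    where
    assoc : ∀ a b c → a + (b + (c + 0)) ≡ a + b + c
    assoc = solve-∀
  halving-shapes-∋a ● ○ ● eq  = contradiction eq (>⇒≢ c<a+b+e)
  halving-shapes-∋a ● ○ ○ eq  = contradiction eq (<⇒≢ a+b<c+e)
  halving-shapes-∋a ○ ● ● eq  = contradiction eq (>⇒≢ b<a+c+e)
  halving-shapes-∋a ○ ● ○ eq  = contradiction eq (<⇒≢ a+c<b+e)
  halving-shapes-∋a ○ ○ ● eq  = inj₂ (trans (cong (a +_) (sym (+-identityʳ e))) (trans eq (cong (b +_) (+-identityʳ c))))
  halving-shapes-∋a ○ ○ ○ eq  = contradiction eq (<⇒≢ a<b+c+e)

  halving-shapes : ∀ P → subSum A P ≡ subSum A (∁ P) → e ≡ a + b + c ⊎ a + e ≡ b + c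
  halving-shapes (● ∷ x ∷ y ∷ z ∷ []) eq = halving-shapes-∋a x y z eq
  halving-shapes (○ ∷ ● ∷ ● ∷ ● ∷ []) eq = halving-shapes-∋a ○ ○ ○ (sym eq)
  halving-shapes (○ ∷ ● ∷ ● ∷ ○ ∷ []) eq = halving-shapes-∋a ○ ○ ● (sym eq)
  halving-shapes (○ ∷ ● ∷ ○ ∷ ● ∷ []) eq = halving-shapes-∋a ○ ● ○ (sym eq)
  halving-shapes (○ ∷ ● ∷ ○ ∷ ○ ∷ []) eq = halving-shapes-∋a ○ ● ● (sym eq)
  halving-shapes (○ ∷ ○ ∷ ● ∷ ● ∷ []) eq = halving-shapes-∋a ● ○ ○ (sym eq)
  halving-shapes (○ ∷ ○ ∷ ● ∷ ○ ∷ []) eq = halving-shapes-∋a ● ○ ● (sym eq)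
  halving-shapes (○ ∷ ○ ∷ ○ ∷ ● ∷ []) eq = halving-shapes-∋a ● ● ○ (sym eq)
  halving-shapes (○ ∷ ○ ∷ ○ ∷ ○ ∷ []) eq = halving-shapes-∋a ● ● ● (sym eq)

  0<x+0 : ∀ {x} → 0 < x → 0 < x + 0
  0<x+0 {x} 0<x = ≤-trans 0<x (m≤m+n x 0)

  Bᵃᵇ Bᵃᶜ Bᶜ Bᵉ : Subset 4
  Bᵃᵇ = ● ∷ ● ∷ ○ ∷ ○ ∷ []
  Bᵃᶜ = ● ∷ ○ ∷ ● ∷ ○ ∷ []
  Bᶜ  = ○ ∷ ○ ∷ ● ∷ ○ ∷ []
  Bᵉ  = ○ ∷ ○ ∷ ○ ∷ ● ∷ []

  tᵃᵇ tᵃᶜ tᶜ tᵉ : ℕ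
  tᵃᵇ = t Bᵃᵇ
  tᵃᶜ = t Bᵃᶜ
  tᶜ  = t Bᶜ
  tᵉ  = t Bᵉ

  module HalvingAE (a+e≡b+c : a + e ≡ b + c) where

    h : ℕ
    h = b + c

    e<h : e < h
    e<h = subst (e <_) a+e≡b+c (m<n+m e 0<a)

    e<a+b+c : e + 0 < a + (b + (c + 0))
    e<a+b+c = <-≤-trans (subst (_< h) (sym (+-identityʳ e)) e<h)
                        (subst (h ≤_) (cong (λ x → a + (b + x)) (sym (+-identityʳ c))) (m≤n+m h a))

    bound : Subset 4 → ℕ
    bound (● ∷ ● ∷ ● ∷ ○ ∷ []) = 0
    bound (● ∷ ● ∷ ○ ∷ ● ∷ []) = 0
    bound (● ∷ ○ ∷ ● ∷ ● ∷ []) = 0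
    bound (○ ∷ ● ∷ ● ∷ ● ∷ []) = 0
    bound (○ ∷ ● ∷ ○ ∷ ● ∷ []) = 0
    bound (○ ∷ ○ ∷ ● ∷ ● ∷ []) = 0
    bound (○ ∷ ○ ∷ ○ ∷ ○ ∷ []) = 0
    bound (● ∷ ○ ∷ ● ∷ ○ ∷ []) = tᵃᶜ
    bound (○ ∷ ○ ∷ ● ∷ ○ ∷ []) = tᶜ
    bound (○ ∷ ○ ∷ ○ ∷ ● ∷ []) = tᵉ
    bound _                    = 1

    t≤bound : ∀ B → t B ≤ bound B
    t≤bound B@(● ∷ ● ∷ ● ∷ ● ∷ []) = 𝟙≤1 (divisor? A B)
    t≤bound B@(● ∷ ● ∷ ● ∷ ○ ∷ []) = ¬divisor⇒≤0 A B (heavier⇒¬divisor A B (0<x+0 (<-trans 0<c c<e)) e<a+b+c)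
    t≤bound B@(● ∷ ● ∷ ○ ∷ ● ∷ []) = ¬divisor⇒≤0 A B (heavier⇒¬divisor A B (0<x+0 0<c) c<a+b+e)
    t≤bound B@(● ∷ ● ∷ ○ ∷ ○ ∷ []) = 𝟙≤1 (divisor? A B)
    t≤bound B@(● ∷ ○ ∷ ● ∷ ● ∷ []) = ¬divisor⇒≤0 A B (heavier⇒¬divisor A B (0<x+0 0<b) b<a+c+e)
    t≤bound B@(● ∷ ○ ∷ ● ∷ ○ ∷ []) = ≤-refl
    t≤bound B@(● ∷ ○ ∷ ○ ∷ ● ∷ []) = 𝟙≤1 (divisor? A B)
    t≤bound B@(● ∷ ○ ∷ ○ ∷ ○ ∷ []) = 𝟙≤1 (divisor? A B)
    t≤bound B@(○ ∷ ● ∷ ● ∷ ● ∷ []) = ¬divisor⇒≤0 A B (heavier⇒¬divisor A B (0<x+0 0<a) a<b+c+e)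
    t≤bound B@(○ ∷ ● ∷ ● ∷ ○ ∷ []) = 𝟙≤1 (divisor? A B)
    t≤bound B@(○ ∷ ● ∷ ○ ∷ ● ∷ []) = ¬divisor⇒≤0 A B (heavier⇒¬divisor A B (≤-trans 0<a (m≤m+n a _)) a+c<b+e)
    t≤bound B@(○ ∷ ● ∷ ○ ∷ ○ ∷ []) = 𝟙≤1 (divisor? A B)
    t≤bound B@(○ ∷ ○ ∷ ● ∷ ● ∷ []) = ¬divisor⇒≤0 A B (heavier⇒¬divisor A B (≤-trans 0<a (m≤m+n a _)) a+b<c+e)
    t≤bound B@(○ ∷ ○ ∷ ● ∷ ○ ∷ []) = ≤-refl
    t≤bound B@(○ ∷ ○ ∷ ○ ∷ ● ∷ []) = ≤-refl
    t≤bound B@(○ ∷ ○ ∷ ○ ∷ ○ ∷ []) = ¬divisor⇒≤0 A B (sum≡0⇒¬divisor A 0<S B refl)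

    d≤6+tᵃᶜ+tᶜ+tᵉ : d A ≤ 6 + (tᵃᶜ + (tᶜ + tᵉ))
    d≤6+tᵃᶜ+tᶜ+tᵉ = ≤-trans (d≤sumSubsets A bound t≤bound) (≤-reflexive (collect tᵃᶜ tᶜ tᵉ))
      where
      collect : ∀ x y z → (((1 + 0) + (0 + 1)) + ((0 + x) + (1 + 1))) + (((0 + 1) + (0 + 1)) + ((0 + y) + (z + 0)))
                          ≡ 6 + (x + (y + z))
      collect = solve-∀

    S≡h+h : S ≡ h + h
    S≡h+h = trans (regroup a b c e) (cong (_+ h) a+e≡b+c)
      where
      regroup : ∀ a b c e → a + (b + (c + (e + 0))) ≡ (a + e) + (b + c)
      regroup = solve-∀

    -- Each of a + c, c, e lies strictly between h/2 and h, so as a divisor of S = 2h it is S/3.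
    third : ∀ {x} → x ∣ S → x < h → h < 2 * x → 3 * x ≡ S
    third {x} x∣S x<h h<2x = ∣∧k*m<n<[2+k]*m⇒[1+k]*m≡n 2 x∣S
      (subst (2 * x <_) (sym S≡h+h) (subst (_< h + h) (cong (x +_) (sym (+-identityʳ x))) (+-mono-< x<h x<h)))
      (subst (_< 4 * x) (sym S≡h+h) (subst (h + h <_) (double x) (+-mono-< h<2x h<2x)))
      where
      double : ∀ x → 2 * x + 2 * x ≡ 4 * x
      double = solve-∀

    third-ac : IsDivisor A Bᵃᶜ → 3 * (a + c) ≡ S
    third-ac p = third (subst (_∣ S) (cong (a +_) (+-identityʳ c)) p) (+-monoˡ-< c a<b)
      (subst (h <_) (cong ((a + c) +_) (sym (+-identityʳ (a + c)))) (+-mono-< (<-≤-trans b<c (m≤n+m c a)) (m<n+m c 0<a)))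

    third-c : IsDivisor A Bᶜ → 3 * c ≡ S
    third-c q = third (subst (_∣ S) (+-identityʳ c) q) (m<n+m c 0<b)
      (subst (h <_) (cong (c +_) (sym (+-identityʳ c))) (+-monoˡ-< c b<c))

    third-e : IsDivisor A Bᵉ → 3 * e ≡ S
    third-e r = third (subst (_∣ S) (+-identityʳ e) r) e<h
      (subst (h <_) (cong (e +_) (sym (+-identityʳ e))) (+-mono-< b<e c<e))

    ¬[ac∧c] : IsDivisor A Bᵃᶜ → IsDivisor A Bᶜ → ⊥
    ¬[ac∧c] p q = >⇒≢ (m<n+m c 0<a) (*-cancelˡ-≡ _ _ 3 (trans (third-ac p) (sym (third-c q))))

    ¬[c∧e] : IsDivisor A Bᶜ → IsDivisor A Bᵉ → ⊥
    ¬[c∧e] q r = <⇒≢ c<e (*-cancelˡ-≡ _ _ 3 (trans (third-c q) (sym (third-e r))))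

    -- a + c = e together with a + e = b + c forces b = 2a, and then 3(a + c) = 2(b + c) forces c = a.
    ¬[ac∧e] : IsDivisor A Bᵃᶜ → IsDivisor A Bᵉ → ⊥
    ¬[ac∧e] p r = >⇒≢ a<c (+-cancelʳ-≡ (3 * a + 2 * c) c a (begin
      c + (3 * a + 2 * c)               ≡⟨ lhs a c ⟩
      3 * (a + c)                       ≡⟨ third-ac p ⟩
      S                                 ≡⟨ S≡h+h ⟩
      h + h                             ≡⟨ cong₂ _+_ b+c≡2a+c b+c≡2a+c ⟩
      (a + (a + c)) + (a + (a + c))     ≡⟨ rhs a c ⟩
      a + (3 * a + 2 * c)               ∎))
      where
      open ≡-Reasoning
      a+c≡e : a + c ≡ e
      a+c≡e = *-cancelˡ-≡ _ _ 3 (trans (third-ac p) (sym (third-e r)))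
      b+c≡2a+c : b + c ≡ a + (a + c)
      b+c≡2a+c = trans (sym a+e≡b+c) (cong (a +_) (sym a+c≡e))
      lhs : ∀ a c → c + (3 * a + 2 * c) ≡ 3 * (a + c)
      lhs = solve-∀
      rhs : ∀ a c → (a + (a + c)) + (a + (a + c)) ≡ a + (3 * a + 2 * c)
      rhs = solve-∀

    d≤7 : d A ≤ 7
    d≤7 = ≤-trans d≤6+tᵃᶜ+tᶜ+tᵉ
      (+-monoʳ-≤ 6 (𝟙-at-most-one (divisor? A Bᵃᶜ) (divisor? A Bᶜ) (divisor? A Bᵉ) ¬[ac∧c] ¬[ac∧e] ¬[c∧e]))

  module HalvingE (e≡a+b+c : e ≡ a + b + c) where

    N : ℕ
    N = 2 * a + 2 * b + 2 * c

    S≡N : S ≡ N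
    S≡N = trans (cong (λ e → a + (b + (c + (e + 0)))) e≡a+b+c) (expand a b c)
      where
      expand : ∀ a b c → a + (b + (c + ((a + b + c) + 0))) ≡ 2 * a + 2 * b + 2 * c
      expand = solve-∀

    b+c<a+e : b + (c + 0) < a + (e + 0)
    b+c<a+e = <-≤-trans
      (subst₂ _<_ (cong (b +_) (sym (+-identityʳ c)))
                  (trans (sym (+-assoc a b c)) (trans (sym e≡a+b+c) (sym (+-identityʳ e))))
                  (m<n+m (b + c) 0<a))
      (m≤n+m (e + 0) a)

    b+c∤S : ¬ b + (c + 0) ∣ S
    b+c∤S = k*m<n<[1+k]*m⇒m∤n 2
      (begin-strict
        2 * (b + (c + 0))           ≡⟨ split b c ⟩
        0 + 2 * b + 2 * c           <⟨ +-monoˡ-< (2 * c) (+-monoˡ-< (2 * b) (*-monoʳ-< 2 0<a)) ⟩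
        N                           ≡⟨ S≡N ⟨
        S                           ∎)
      (begin-strict
        S                           ≡⟨ trans S≡N (regroup a b c) ⟩
        (a + a) + (2 * b + 2 * c)   <⟨ +-monoˡ-< (2 * b + 2 * c) (+-mono-< a<b a<c) ⟩
        (b + c) + (2 * b + 2 * c)   ≡⟨ collect b c ⟩
        3 * (b + (c + 0))           ∎)
      where
      open ≤-Reasoning
      split : ∀ b c → 2 * (b + (c + 0)) ≡ 0 + 2 * b + 2 * c
      split = solve-∀
      regroup : ∀ a b c → 2 * a + 2 * b + 2 * c ≡ (a + a) + (2 * b + 2 * c)
      regroup = solve-∀
      collect : ∀ b c → (b + c) + (2 * b + 2 * c) ≡ 3 * (b + (c + 0))
      collect = solve-∀

    bound : Subset 4 → ℕ
    bound (● ∷ ● ∷ ○ ∷ ● ∷ []) = 0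
    bound (● ∷ ○ ∷ ● ∷ ● ∷ []) = 0
    bound (● ∷ ○ ∷ ○ ∷ ● ∷ []) = 0
    bound (○ ∷ ● ∷ ● ∷ ● ∷ []) = 0
    bound (○ ∷ ● ∷ ● ∷ ○ ∷ []) = 0
    bound (○ ∷ ● ∷ ○ ∷ ● ∷ []) = 0
    bound (○ ∷ ○ ∷ ● ∷ ● ∷ []) = 0
    bound (○ ∷ ○ ∷ ○ ∷ ○ ∷ []) = 0
    bound (● ∷ ● ∷ ○ ∷ ○ ∷ []) = tᵃᵇ
    bound (● ∷ ○ ∷ ● ∷ ○ ∷ []) = tᵃᶜ
    bound (○ ∷ ○ ∷ ● ∷ ○ ∷ []) = tᶜ
    bound _                    = 1

    t≤bound : ∀ B → t B ≤ bound B
    t≤bound B@(● ∷ ● ∷ ● ∷ ● ∷ []) = 𝟙≤1 (divisor? A B)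
    t≤bound B@(● ∷ ● ∷ ● ∷ ○ ∷ []) = 𝟙≤1 (divisor? A B)
    t≤bound B@(● ∷ ● ∷ ○ ∷ ● ∷ []) = ¬divisor⇒≤0 A B (heavier⇒¬divisor A B (0<x+0 0<c) c<a+b+e)
    t≤bound B@(● ∷ ● ∷ ○ ∷ ○ ∷ []) = ≤-refl
    t≤bound B@(● ∷ ○ ∷ ● ∷ ● ∷ []) = ¬divisor⇒≤0 A B (heavier⇒¬divisor A B (0<x+0 0<b) b<a+c+e)
    t≤bound B@(● ∷ ○ ∷ ● ∷ ○ ∷ []) = ≤-refl
    t≤bound B@(● ∷ ○ ∷ ○ ∷ ● ∷ []) = ¬divisor⇒≤0 A B (heavier⇒¬divisor A B (≤-trans 0<b (m≤m+n b _)) b+c<a+e)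
    t≤bound B@(● ∷ ○ ∷ ○ ∷ ○ ∷ []) = 𝟙≤1 (divisor? A B)
    t≤bound B@(○ ∷ ● ∷ ● ∷ ● ∷ []) = ¬divisor⇒≤0 A B (heavier⇒¬divisor A B (0<x+0 0<a) a<b+c+e)
    t≤bound B@(○ ∷ ● ∷ ● ∷ ○ ∷ []) = ¬divisor⇒≤0 A B b+c∤S
    t≤bound B@(○ ∷ ● ∷ ○ ∷ ● ∷ []) = ¬divisor⇒≤0 A B (heavier⇒¬divisor A B (≤-trans 0<a (m≤m+n a _)) a+c<b+e)
    t≤bound B@(○ ∷ ● ∷ ○ ∷ ○ ∷ []) = 𝟙≤1 (divisor? A B)
    t≤bound B@(○ ∷ ○ ∷ ● ∷ ● ∷ []) = ¬divisor⇒≤0 A B (heavier⇒¬divisor A B (≤-trans 0<a (m≤m+n a _)) a+b<c+e)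
    t≤bound B@(○ ∷ ○ ∷ ● ∷ ○ ∷ []) = ≤-refl
    t≤bound B@(○ ∷ ○ ∷ ○ ∷ ● ∷ []) = 𝟙≤1 (divisor? A B)
    t≤bound B@(○ ∷ ○ ∷ ○ ∷ ○ ∷ []) = ¬divisor⇒≤0 A B (sum≡0⇒¬divisor A 0<S B refl)

    d≤5+tᵃᵇ+tᵃᶜ+tᶜ : d A ≤ 5 + (tᵃᵇ + (tᵃᶜ + tᶜ))
    d≤5+tᵃᵇ+tᵃᶜ+tᶜ = ≤-trans (d≤sumSubsets A bound t≤bound) (≤-reflexive (collect tᵃᵇ tᵃᶜ tᶜ))
      where
      collect : ∀ x y z → (((1 + 1) + (0 + x)) + ((0 + y) + (0 + 1))) + (((0 + 0) + (0 + 1)) + ((0 + z) + (1 + 0)))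
                          ≡ 5 + (x + (y + z))
      collect = solve-∀

    d≡8⇒b≡2a∧c≡3a : d A ≡ 8 → b ≡ 2 * a × c ≡ 3 * a
    d≡8⇒b≡2a∧c≡3a d≡8 =
      let p , q , r = 𝟙+𝟙+𝟙≥3 (divisor? A Bᵃᵇ) (divisor? A Bᵃᶜ) (divisor? A Bᶜ)
                        (+-cancelˡ-≤ 5 _ _ (subst (_≤ 5 + (tᵃᵇ + (tᵃᶜ + tᶜ))) d≡8 d≤5+tᵃᵇ+tᵃᶜ+tᶜ))
      in divisors-of-2[a+b+c]⇒shape 0<a a<b b<c
           (subst₂ _∣_ (cong (a +_) (+-identityʳ b)) S≡N p)
           (subst₂ _∣_ (cong (a +_) (+-identityʳ c)) S≡N q)
           (subst₂ _∣_ (+-identityʳ c) S≡N r)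

    d≡8⇒shape : d A ≡ 8 → toList A ≡ a ∷ 2 * a ∷ 3 * a ∷ 6 * a ∷ []
    d≡8⇒shape d≡8 = let b≡2a , c≡3a = d≡8⇒b≡2a∧c≡3a d≡8 in begin
      a ∷ b ∷ c ∷ e ∷ []                           ≡⟨ cong (λ e → a ∷ b ∷ c ∷ e ∷ []) e≡a+b+c ⟩
      a ∷ b ∷ c ∷ (a + b + c) ∷ []                 ≡⟨ cong₂ (λ b c → a ∷ b ∷ c ∷ (a + b + c) ∷ []) b≡2a c≡3a ⟩
      a ∷ 2 * a ∷ 3 * a ∷ (a + 2 * a + 3 * a) ∷ [] ≡⟨ cong (λ e → a ∷ 2 * a ∷ 3 * a ∷ e ∷ []) (collect a) ⟩
      a ∷ 2 * a ∷ 3 * a ∷ 6 * a ∷ []               ∎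
      where
      open ≡-Reasoning
      collect : ∀ a → a + 2 * a + 3 * a ≡ 6 * a
      collect = solve-∀

  d≡8⇒antiPencil⊎shape : IsPosSet A → d A ≡ 8 →
    AntiPencil A ⊎ ∃[ x ] (0 < x × toList A ≡ x ∷ 2 * x ∷ 3 * x ∷ 6 * x ∷ [])
  d≡8⇒antiPencil⊎shape ip d≡8 with bothCount≡0⊎halving A 0<S
  ... | inj₁ both≡0 = inj₁ (exactlyOne⇒antiPencil A ip (d≡2^m∧both≡0⇒exactlyOne A d≡8 both≡0))
  ... | inj₂ (P , 2p≡S) with halving-shapes P (halving⇒sum≡sum∁ A P 2p≡S)
  ...   | inj₂ a+e≡b+c = contradiction (subst (_≤ 7) d≡8 (HalvingAE.d≤7 a+e≡b+c)) (<⇒≱ (n<1+n 7))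
  ...   | inj₁ e≡a+b+c = inj₂ (a , 0<a , HalvingE.d≡8⇒shape e≡a+b+c d≡8)

d≤2^m : ∀ m → suc m ≢ 3 → (A : Vec ℕ (suc m)) → IsPosSet A → d A ≤ 2 ^ m
d≤2^m 0                   _   A ip = both≡0⇒d≤2^m A (both≡0-of-≤2 0 z≤n A ip)
d≤2^m 1                   _   A ip = both≡0⇒d≤2^m A (both≡0-of-≤2 1 ≤-refl A ip)
d≤2^m 2                   3≢3 _ _  = contradiction refl 3≢3
d≤2^m (suc (suc (suc k))) _   A ip = d≤2^m-of-≥4 k A ip

d≡2^m⇒antiPencil⊎shape : ∀ m → suc m ≢ 3 → (A : Vec ℕ (suc m)) → IsPosSet A → d A ≡ 2 ^ m →
  AntiPencil A ⊎ ∃[ a ] (0 < a × toList A ≡ a ∷ 2 * a ∷ 3 * a ∷ 6 * a ∷ [])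
d≡2^m⇒antiPencil⊎shape 0 _ A ip d≡2^m =
  inj₁ (exactlyOne⇒antiPencil A ip (d≡2^m∧both≡0⇒exactlyOne A d≡2^m (both≡0-of-≤2 0 z≤n A ip)))
d≡2^m⇒antiPencil⊎shape 1 _ A ip d≡2^m =
  inj₁ (exactlyOne⇒antiPencil A ip (d≡2^m∧both≡0⇒exactlyOne A d≡2^m (both≡0-of-≤2 1 ≤-refl A ip)))
d≡2^m⇒antiPencil⊎shape 2 3≢3 _ _ _ = contradiction refl 3≢3
d≡2^m⇒antiPencil⊎shape 3 _ A@(a ∷ b ∷ c ∷ e ∷ []) ip@(pos , _) d≡8 =
  FourElements.d≡8⇒antiPencil⊎shape a b c e (pos (# 0))
    (ascending A ip (# 0) (# 1)) (ascending A ip (# 1) (# 2)) (ascending A ip (# 2) (# 3)) ip d≡8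
d≡2^m⇒antiPencil⊎shape (suc (suc (suc (suc k)))) _ A ip d≡2^m =
  inj₁ (exactlyOne⇒antiPencil A ip (d≡2^m∧both≡0⇒exactlyOne A d≡2^m (d≡2^m⇒both≡0-of-≥5 k A ip d≡2^m)))

antiPencil⊎shape⇒d≡2^m : ∀ m (A : Vec ℕ (suc m)) → IsPosSet A →
  AntiPencil A ⊎ ∃[ a ] (0 < a × toList A ≡ a ∷ 2 * a ∷ 3 * a ∷ 6 * a ∷ []) → d A ≡ 2 ^ m
antiPencil⊎shape⇒d≡2^m m A ip (inj₁ ap) = exactlyOne⇒d≡2^m A (antiPencil⇒exactlyOne A ip ap)
antiPencil⊎shape⇒d≡2^m 3 (_ ∷ _ ∷ _ ∷ _ ∷ []) _ (inj₂ (a , 0<a , refl)) = d-of-a,2a,3a,6a a 0<a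
antiPencil⊎shape⇒d≡2^m 0 (_ ∷ []) _ (inj₂ (_ , _ , ()))
antiPencil⊎shape⇒d≡2^m 1 (_ ∷ _ ∷ []) _ (inj₂ (_ , _ , ()))
antiPencil⊎shape⇒d≡2^m 2 (_ ∷ _ ∷ _ ∷ []) _ (inj₂ (_ , _ , ()))
antiPencil⊎shape⇒d≡2^m (suc (suc (suc (suc k)))) (_ ∷ _ ∷ _ ∷ _ ∷ _ ∷ _) _ (inj₂ (_ , _ , ()))

d≤5-of-3 : (A : Vec ℕ 3) → IsPosSet A → d A ≤ 5
d≤5-of-3 A@(a ∷ b ∷ c ∷ []) ip@(pos , _) =
  ThreeElements.d≤5 a b c (pos (# 0)) (ascending A ip (# 0) (# 1)) (ascending A ip (# 1) (# 2))

d≡5⇔shape-of-3 : (A : Vec ℕ 3) → IsPosSet A → d A ≡ 5 ⇔ (∃[ a ] (0 < a × toList A ≡ a ∷ 2 * a ∷ 3 * a ∷ []))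
d≡5⇔shape-of-3 A@(a ∷ b ∷ c ∷ []) ip@(pos , _) = mk⇔
  (λ d≡5 → let b≡2a , c≡3a = ThreeElements.d≡5⇒shape a b c (pos (# 0)) (ascending A ip (# 0) (# 1))
                                 (ascending A ip (# 1) (# 2)) d≡5
           in a , pos (# 0) , cong₂ (λ b c → a ∷ b ∷ c ∷ []) b≡2a c≡3a)
  λ { (a , 0<a , refl) → d-of-a,2a,3a a 0<a }

mainTheorem1 : (∀ (m : ℕ) → suc m ≢ 3 →
    ((∀ (A : Vec ℕ (suc m)) → IsPosSet A → d A ≤ 2 ^ m)
     × (∃[ A ] (IsPosSet {suc m} A × d A ≡ 2 ^ m))
     × (∀ (A : Vec ℕ (suc m)) → IsPosSet A →
          (d A ≡ 2 ^ m ⇔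
            (AntiPencil A
             ⊎ ∃[ a ] (0 < a × toList A ≡ a ∷ 2 * a ∷ 3 * a ∷ 6 * a ∷ []))))))
  ×
  ((∀ (A : Vec ℕ 3) → IsPosSet A → d A ≤ 5)
   × (∃[ A ] (IsPosSet {3} A × d A ≡ 5))
   × (∀ (A : Vec ℕ 3) → IsPosSet A →
        (d A ≡ 5 ⇔ (∃[ a ] (0 < a × toList A ≡ a ∷ 2 * a ∷ 3 * a ∷ [])))))
mainTheorem1 =
  (λ m m+1≢3 →
     d≤2^m m m+1≢3 ,
     (let A , ip , ap = antiPencil-witness m in A , ip , exactlyOne⇒d≡2^m A (antiPencil⇒exactlyOne A ip ap)) ,
     λ A ip → mk⇔ (d≡2^m⇒antiPencil⊎shape m m+1≢3 A ip) (antiPencil⊎shape⇒d≡2^m m A ip)) ,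
  (d≤5-of-3 , (1 ∷ 2 ∷ 3 ∷ [] , consecutiveThen-IsPosSet 1 2 3 (s≤s z≤n) ≤-refl , refl) , d≡5⇔shape-of-3)
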